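{- For integers $j,k,m,n$ with $m,n\ge 2$ (and $m\ge 3$, resp. $n\ge 3$, whenever $C_m$, resp. $C_n$, appears; $j,k\ge 1$, with $2j\ge 3$ where $C_{2j}$ appears), the following hold: 1. $C_{cc}(K_m\boxtimes K_n)=C_{cc}(K_m\circ K_n)=1$; 2. $C_{cc}(K_m\boxtimes C_n)=C_{cc}(K_m\circ C_n)=\lfloor n/2\rfloor$; 3. $C_{cc}(K_m\boxtimes P_n)=C_{cc}(K_m\circ P_n)=\lceil n/2\rceil$; 4. $C_{cc}(C_m\circ C_n)=\lfloor m/2\rfloor\lfloor n/2\rfloor$; 5. $C_{cc}(C_{2j}\boxtimes C_n)=j\lfloor n/2\rfloor$; 6. $C_{cc}(C_{2j+1}\boxtimes C_{2k+1})=jk+\lfloor k/2\rfloor$ whenever $j\ge k$; 7. $C_{cc}(C_m\boxtimes P_n)=C_{cc}(C_m\circ P_n)=\lfloor m/2\rfloor\lceil n/2\rceil$; 8. $C_{cc}(P_m\boxtimes P_n)=C_{cc}(P_m\circ P_n)=\lceil m/2\rceil\lceil n/2\rceil$.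
   Context: All graphs are finite, simple and undirected. Cycle convexity on a graph $G$: for $S\subseteq V(G)$, the cycle interval $\langle S\rangle$ is $S$ together with every vertex $w\in V(G)$ that lies on a cycle of the induced subgraph $G[S\cup\{w\}]$ passing through $w$. $S$ is (cycle) convex if $\langle S\rangle=S$. The cycle convexity number $C_{cc}(G)$ is the maximum cardinality of a proper (i.e. $\neq V(G)$) convex subset of $V(G)$. The strong product $G\boxtimes H$ has vertex set $V(G)\times V(H)$, with $(g_1,h_1)\sim(g_2,h_2)$ iff ($g_1\sim g_2$ and $h_1=h_2$) or ($g_1=g_2$ and $h_1\sim h_2$) or ($g_1\sim g_2$ and $h_1\sim h_2$). The lexicographic product $G\circ H$ has vertex set $V(G)\times V(H)$, with $(g_1,h_1)\sim(g_2,h_2)$ iff $g_1\sim g_2$, or ($g_1=g_2$ and $h_1\sim h_2$). $K_k$, $C_k$, $P_k$ denote the complete graph, cycle and path on $k$ vertices. -}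

module Defs where

open import Level using (0ℓ)
open import Data.Nat using (ℕ; zero; suc; _+_; _*_; _%_; _≤_)
open import Data.Fin using (Fin; zero; suc; toℕ; fromℕ; inject₁; remQuot)
open import Data.Fin.Subset using (Subset; _∈_; _∉_; _∪_; ⁅_⁆; ⊤; ∣_∣)
open import Data.Product using (Σ; _×_; _,_; proj₁; proj₂; ∃)
open import Data.Sum using (_⊎_)
open import Relation.Binary.PropositionalEquality using (_≡_; _≢_)
open import Function.Definitions using (Injective)

Graph : ℕ → Set₁
Graph n = Fin n → Fin n → Set

K : (n : ℕ) → Graph n
K n i j = i ≢ j

-- Cycle C_n (vertices 0..n-1, i ~ i+1 mod n); used for n ≥ 3
C : (n : ℕ) → Graph n
C (suc n) i j = (toℕ j ≡ (suc (toℕ i)) % (suc n)) ⊎ (toℕ i ≡ (suc (toℕ j)) % (suc n))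
C zero () ()

P : (n : ℕ) → Graph n
P n i j = (toℕ j ≡ suc (toℕ i)) ⊎ (toℕ i ≡ suc (toℕ j))

-- Products; the vertex (g , h) of V(G) × V(H) is encoded as  combine g h : Fin (m * n),
-- decoded by  remQuot n.
StrongRel : ∀ {m n} → Graph m → Graph n → Fin m × Fin n → Fin m × Fin n → Set
StrongRel G H (g₁ , h₁) (g₂ , h₂) =
  (G g₁ g₂ × h₁ ≡ h₂) ⊎ (g₁ ≡ g₂ × H h₁ h₂) ⊎ (G g₁ g₂ × H h₁ h₂)

LexRel : ∀ {m n} → Graph m → Graph n → Fin m × Fin n → Fin m × Fin n → Set
LexRel G H (g₁ , h₁) (g₂ , h₂) = G g₁ g₂ ⊎ (g₁ ≡ g₂ × H h₁ h₂)

_⊠_ : ∀ {m n} → Graph m → Graph n → Graph (m * n)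
_⊠_ {m} {n} G H x y = StrongRel G H (remQuot n x) (remQuot n y)

_⊙_ : ∀ {m n} → Graph m → Graph n → Graph (m * n)
_⊙_ {m} {n} G H x y = LexRel G H (remQuot n x) (remQuot n y)

CycleThrough : ∀ {n} → Graph n → Subset n → Fin n → Set
CycleThrough {n} G T w =
  Σ ℕ λ k → Σ (Fin (suc (suc (suc k))) → Fin n) λ f →
    Injective _≡_ _≡_ f
    × f zero ≡ w
    × (∀ i → f i ∈ T)
    × (∀ (i : Fin (suc (suc k))) → G (f (inject₁ i)) (f (suc i)))
    × G (f (fromℕ (suc (suc k)))) (f zero)

-- w belongs to the cycle interval ⟨S⟩ (beyond S itself)
OnCycle : ∀ {n} → Graph n → Subset n → Fin n → Set
OnCycle G S w = CycleThrough G (S ∪ ⁅ w ⁆) w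

Convex : ∀ {n} → Graph n → Subset n → Set
Convex {n} G S = ∀ (w : Fin n) → OnCycle G S w → w ∈ S

IsCcc : ∀ {n} → Graph n → ℕ → Set
IsCcc {n} G c =
  (Σ (Subset n) λ S → Convex G S × S ≢ ⊤ × ∣ S ∣ ≡ c)
  × (∀ (S : Subset n) → Convex G S → S ≢ ⊤ → ∣ S ∣ ≤ c)

{-# OPTIONS --safe #-}
module Submission where

open import Defs
open import Data.Bool using (Bool; true; false; T; _∧_; _∨_)
open import Data.Bool.Properties using (T-∧; T-∨; T-≡)
open import Data.Empty using (⊥-elim)
open import Data.Fin using (Fin; zero; suc; toℕ; fromℕ; fromℕ<; inject₁; combine; remQuot; _↑ˡ_; _↑ʳ_)
open import Data.Fin.Patterns using (0F; 1F; 2F)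
import Data.Fin.Properties as Finₚ
open import Data.Fin.Properties
  using (_≟_; any?; toℕ-fromℕ<; toℕ-inject₁; toℕ-fromℕ; toℕ-injective; remQuot-combine; combine-remQuot)
open import Data.Fin.Subset using (Subset; _∈_; _∪_; ⁅_⁆; ⊤; ∣_∣)
open import Data.Fin.Subset.Properties using (x∈p∪q⁻; x∈p∪q⁺; x∈⁅y⁆⇒x≡y; x∈⁅x⁆; ∈⊤; ⊆⊤; ⊆-antisym)
open import Data.Nat using (ℕ; zero; suc; pred; _+_; _*_; _∸_; _≤_; _<_; _%_; z≤n; s≤s; ⌊_/2⌋; ⌈_/2⌉; NonZero)
open import Data.Nat.DivMod
  using (_/_; m%n<n; m<n⇒m%n≡m; n%n≡0; m≡m%n+[m/n]*n; m%n%n≡m%n; %-distribˡ-+; [m+kn]%n≡m%n)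
open import Data.Nat.Properties hiding (_≟_)
open import Algebra.Properties.Semiring.Sum +-*-semiring
  using (sum; sum-syntax; sum-cong-≗; ∑-comm; ∑-distrib-+; *-distribˡ-sum; *-distribʳ-sum; sum-init-last)
open import Data.Nat.Tactic.RingSolver using (solve-∀)
open import Data.Product using (Σ; _×_; _,_; ∃; ∃₂; proj₁; proj₂; swap; uncurry)
open import Data.Sum using (_⊎_; inj₁; inj₂)
open import Data.Vec using ([]; _∷_; lookup; tabulate)
open import Data.Vec.Properties using (lookup⇒[]=; []=⇒lookup; lookup∘tabulate)
open import Function using (_∘_; _on_; Equivalence)
open import Function.Definitions using (Injective)
open import Level using (0ℓ)
open import Relation.Binary using (Rel; Symmetric; Irreflexive; tri<; tri≈; tri>)
open import Relation.Binary.PropositionalEquality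
open import Relation.Nullary using (¬_; yes; no)
open import Relation.Nullary.Decidable using (⌊_⌋; ⌊⌋-map′; T?; toWitness; toSum)
open import Relation.Unary using (Pred)

-- A cycle-convex set containing an edge uv also contains every common neighbour w of u and v, since
-- w u v is a triangle. In a strong or lexicographic product of connected graphs, closing one edge under
-- common neighbours reaches every vertex, so a proper convex set is independent; as every independent
-- set is convex, C_cc equals the independence number α. The values of α follow from the factors:
-- products of independent sets give the lower bounds, and α(G ⊠ H) ≤ θ(G) α(H), α(G ∘ H) ≤ α(G) α(H)
-- (θ the size of a clique cover) give the upper bounds; for odd cycles, double counting over the edges
-- of the cycle gives α(Cₙ) ≤ ⌊n/2⌋ and 2 α(C₂ⱼ₊₁ ⊠ H) ≤ (2j+1) α(H). The matching independent set of
-- C₂ⱼ₊₁ ⊠ C₂ₖ₊₁, of size jk + ⌊k/2⌋, is a staircase: pairs of rows carry ⌈k/2⌉ and ⌊k/2⌋ points two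
-- columns apart, each row starting right after the previous one ends, with one empty column inserted
-- after each of the first j − 2⌊k/2⌋ pairs, so that the last row ends exactly j turns around the columns.

-- Finite sums and sizes

𝟙 : Bool → ℕ
𝟙 true = 1
𝟙 false = 0

𝟙≤1 : ∀ b → 𝟙 b ≤ 1
𝟙≤1 true = ≤-refl
𝟙≤1 false = z≤n

𝟙-∧ : ∀ a b → 𝟙 (a ∧ b) ≡ 𝟙 a * 𝟙 b
𝟙-∧ true b = sym (+-identityʳ (𝟙 b))
𝟙-∧ false b = refl

𝟙-∨ : ∀ a b → ¬ (T a × T b) → 𝟙 (a ∨ b) ≡ 𝟙 a + 𝟙 b
𝟙-∨ true true both = ⊥-elim (both _)
𝟙-∨ true false _ = refl
𝟙-∨ false b _ = refl

T⇒𝟙≡1 : ∀ {b} → T b → 𝟙 b ≡ 1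
T⇒𝟙≡1 {true} _ = refl

¬T⇒𝟙≡0 : ∀ {b} → ¬ T b → 𝟙 b ≡ 0
¬T⇒𝟙≡0 {true} ¬t = ⊥-elim (¬t _)
¬T⇒𝟙≡0 {false} _ = refl

∑-mono-≤ : ∀ {n} {f g : Fin n → ℕ} → (∀ i → f i ≤ g i) → sum f ≤ sum g
∑-mono-≤ {zero} _ = z≤n
∑-mono-≤ {suc n} f≤g = +-mono-≤ (f≤g zero) (∑-mono-≤ (f≤g ∘ suc))

∑-const : ∀ n c → ∑[ i < n ] c ≡ n * c
∑-const zero c = refl
∑-const (suc n) c = cong (c +_) (∑-const n c)

∑-δ : ∀ {n} (x : Fin n) → ∑[ y < n ] 𝟙 ⌊ x ≟ y ⌋ ≡ 1
∑-δ {suc n} zero = cong suc (trans (∑-const n 0) (*-zeroʳ n))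
∑-δ {suc (suc n)} (suc x) =
  trans (sum-cong-≗ {suc n} (λ y → cong 𝟙 (⌊⌋-map′ (cong suc) Finₚ.suc-injective (x ≟ y)))) (∑-δ x)

∑-↑ : ∀ m n (f : Fin (m + n) → ℕ) → sum f ≡ ∑[ i < m ] f (i ↑ˡ n) + ∑[ i < n ] f (m ↑ʳ i)
∑-↑ zero n f = refl
∑-↑ (suc m) n f = trans (cong (f zero +_) (∑-↑ m n (f ∘ suc))) (sym (+-assoc (f zero) _ _))

∑-combine : ∀ m n (f : Fin (m * n) → ℕ) → sum f ≡ ∑[ g < m ] ∑[ h < n ] f (combine g h)
∑-combine zero n f = refl
∑-combine (suc m) n f = trans (∑-↑ n (m * n) f) (cong (∑[ h < n ] f (h ↑ˡ m * n) +_) (∑-combine m n (f ∘ (n ↑ʳ_))))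

∑-toℕ-cast : ∀ {m n} → m ≡ n → ∀ (f : ℕ → ℕ) → ∑[ i < m ] f (toℕ i) ≡ ∑[ i < n ] f (toℕ i)
∑-toℕ-cast refl f = refl

next : ∀ {n} → Fin (suc n) → Fin (suc n)
next {n} i = fromℕ< (m%n<n (suc (toℕ i)) (suc n))

next-inject₁ : ∀ {n} (i : Fin n) → next (inject₁ i) ≡ suc i
next-inject₁ {n} i = toℕ-injective (begin
  toℕ (next (inject₁ i))         ≡⟨ toℕ-fromℕ< _ ⟩
  suc (toℕ (inject₁ i)) % suc n  ≡⟨ cong (λ t → suc t % suc n) (toℕ-inject₁ i) ⟩
  suc (toℕ i) % suc n            ≡⟨ m<n⇒m%n≡m (s≤s (Finₚ.toℕ<n i)) ⟩
  suc (toℕ i)                    ∎)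
  where open ≡-Reasoning

next-fromℕ : ∀ n → next (fromℕ n) ≡ zero
next-fromℕ n = toℕ-injective (trans (toℕ-fromℕ< _) (trans (cong (λ t → suc t % suc n) (toℕ-fromℕ n)) (n%n≡0 (suc n))))

∑-rotate : ∀ {n} (f : Fin (suc n) → ℕ) → ∑[ i < suc n ] f (next i) ≡ sum f
∑-rotate {n} f = begin
  ∑[ i < suc n ] f (next i)                             ≡⟨ sum-init-last (f ∘ next) ⟩
  ∑[ i < n ] f (next (inject₁ i)) + f (next (fromℕ n))  ≡⟨ cong₂ _+_ (sum-cong-≗ {n} (cong f ∘ next-inject₁))
                                                                      (cong f (next-fromℕ n)) ⟩
  ∑[ i < n ] f (suc i) + f zero                         ≡⟨ +-comm _ (f zero) ⟩
  sum f                                                 ∎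
  where open ≡-Reasoning

cycle-double-count : ∀ {n} (f : Fin (suc n) → ℕ) b → (∀ i → f i + f (next i) ≤ b) → 2 * sum f ≤ suc n * b
cycle-double-count {n} f b bound = begin
  2 * sum f                                ≡⟨ cong (sum f +_) (+-identityʳ (sum f)) ⟩
  sum f + sum f                            ≡⟨ cong (sum f +_) (∑-rotate f) ⟨
  sum f + ∑[ i < suc n ] f (next i)        ≡⟨ ∑-distrib-+ f (f ∘ next) ⟨
  ∑[ i < suc n ] (f i + f (next i))        ≤⟨ ∑-mono-≤ bound ⟩
  ∑[ i < suc n ] b                         ≡⟨ ∑-const (suc n) b ⟩
  suc n * b                                ∎
  where open ≤-Reasoning

size : ∀ {n} → (Fin n → Bool) → ℕ
size S = sum (𝟙 ∘ S)

AtMostOne : ∀ {n} → (Fin n → Bool) → Set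
AtMostOne S = ∀ x y → T (S x) → T (S y) → x ≡ y

nonempty : ∀ {n} → (Fin n → Bool) → Bool
nonempty S = ⌊ any? (T? ∘ S) ⌋

size-∅ : ∀ {n} (S : Fin n → Bool) → (∀ x → ¬ T (S x)) → size S ≡ 0
size-∅ {n} S empty = trans (sum-cong-≗ {n} (¬T⇒𝟙≡0 ∘ empty)) (trans (∑-const n 0) (*-zeroʳ n))

size-singleton : ∀ {n} {S : Fin n → Bool} {x} → T (S x) → AtMostOne S → size S ≡ 1
size-singleton {n} {S} {x} x∈S unique = trans (sum-cong-≗ {n} indicator) (∑-δ x)
  where
  indicator : ∀ y → 𝟙 (S y) ≡ 𝟙 ⌊ x ≟ y ⌋
  indicator y with x ≟ y
  ... | yes refl = T⇒𝟙≡1 x∈S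
  ... | no x≢y = ¬T⇒𝟙≡0 (x≢y ∘ unique x y x∈S)

size≡𝟙nonempty : ∀ {n} {S : Fin n → Bool} → AtMostOne S → size S ≡ 𝟙 (nonempty S)
size≡𝟙nonempty {S = S} unique with any? (T? ∘ S)
... | yes (x , x∈S) = size-singleton x∈S unique
... | no ∄ = size-∅ S (λ x x∈S → ∄ (x , x∈S))

size≤1 : ∀ {n} {S : Fin n → Bool} → AtMostOne S → size S ≤ 1
size≤1 {S = S} unique = ≤-trans (≤-reflexive (size≡𝟙nonempty unique)) (𝟙≤1 (nonempty S))

size-fibres : ∀ {n c} (S : Fin n → Bool) (κ : Fin n → Fin c) →
              size S ≡ ∑[ q < c ] size (λ x → S x ∧ ⌊ κ x ≟ q ⌋)
size-fibres {n} {c} S κ = begin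
  ∑[ x < n ] 𝟙 (S x)                                ≡⟨ sum-cong-≗ {n} (sym ∘ split) ⟩
  ∑[ x < n ] ∑[ q < c ] 𝟙 (S x ∧ ⌊ κ x ≟ q ⌋)      ≡⟨ ∑-comm (λ x q → 𝟙 (S x ∧ ⌊ κ x ≟ q ⌋)) ⟩
  ∑[ q < c ] ∑[ x < n ] 𝟙 (S x ∧ ⌊ κ x ≟ q ⌋)      ∎
  where
  open ≡-Reasoning
  split : ∀ x → ∑[ q < c ] 𝟙 (S x ∧ ⌊ κ x ≟ q ⌋) ≡ 𝟙 (S x)
  split x = begin
    ∑[ q < c ] 𝟙 (S x ∧ ⌊ κ x ≟ q ⌋)    ≡⟨ sum-cong-≗ {c} (λ q → 𝟙-∧ (S x) _) ⟩
    ∑[ q < c ] (𝟙 (S x) * 𝟙 ⌊ κ x ≟ q ⌋) ≡⟨ *-distribˡ-sum {c} (𝟙 (S x)) _ ⟨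
    𝟙 (S x) * ∑[ q < c ] 𝟙 ⌊ κ x ≟ q ⌋  ≡⟨ cong (𝟙 (S x) *_) (∑-δ (κ x)) ⟩
    𝟙 (S x) * 1                          ≡⟨ *-identityʳ (𝟙 (S x)) ⟩
    𝟙 (S x)                              ∎

image : ∀ {ℓ n} → (Fin ℓ → Fin n) → Fin n → Bool
image F y = nonempty (λ i → ⌊ F i ≟ y ⌋)

image-preimage : ∀ {ℓ n} (F : Fin ℓ → Fin n) {y} → T (image F y) → ∃ λ i → F i ≡ y
image-preimage F y∈ with toWitness y∈
... | i , Fi≡y = i , toWitness Fi≡y

size-image : ∀ {ℓ n} (F : Fin ℓ → Fin n) → Injective _≡_ _≡_ F → size (image F) ≡ ℓ
size-image {ℓ} {n} F F-inj = begin
  ∑[ y < n ] 𝟙 (image F y)              ≡⟨ sum-cong-≗ {n} (λ y → sym (size≡𝟙nonempty (preimage≤1 y))) ⟩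
  ∑[ y < n ] ∑[ i < ℓ ] 𝟙 ⌊ F i ≟ y ⌋   ≡⟨ ∑-comm (λ y i → 𝟙 ⌊ F i ≟ y ⌋) ⟩
  ∑[ i < ℓ ] ∑[ y < n ] 𝟙 ⌊ F i ≟ y ⌋   ≡⟨ sum-cong-≗ {ℓ} (∑-δ ∘ F) ⟩
  ∑[ i < ℓ ] 1                          ≡⟨ trans (∑-const ℓ 1) (*-identityʳ ℓ) ⟩
  ℓ                                     ∎
  where
  open ≡-Reasoning
  preimage≤1 : ∀ y → AtMostOne (λ i → ⌊ F i ≟ y ⌋)
  preimage≤1 y i i′ Fi≡y Fi′≡y = F-inj (trans (toWitness Fi≡y) (sym (toWitness Fi′≡y)))

-- Halves and residues

2*⌊n/2⌋≤n : ∀ n → 2 * ⌊ n /2⌋ ≤ n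
2*⌊n/2⌋≤n n = begin
  2 * ⌊ n /2⌋             ≡⟨ cong (⌊ n /2⌋ +_) (+-identityʳ ⌊ n /2⌋) ⟩
  ⌊ n /2⌋ + ⌊ n /2⌋       ≤⟨ +-monoʳ-≤ ⌊ n /2⌋ (⌊n/2⌋≤⌈n/2⌉ n) ⟩
  ⌊ n /2⌋ + ⌈ n /2⌉       ≡⟨ ⌊n/2⌋+⌈n/2⌉≡n n ⟩
  n                       ∎
  where open ≤-Reasoning

n≤2*⌈n/2⌉ : ∀ n → n ≤ 2 * ⌈ n /2⌉
n≤2*⌈n/2⌉ n = begin
  n                       ≡⟨ ⌊n/2⌋+⌈n/2⌉≡n n ⟨
  ⌊ n /2⌋ + ⌈ n /2⌉       ≤⟨ +-monoˡ-≤ ⌈ n /2⌉ (⌊n/2⌋≤⌈n/2⌉ n) ⟩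
  ⌈ n /2⌉ + ⌈ n /2⌉       ≡⟨ cong (⌈ n /2⌉ +_) (+-identityʳ ⌈ n /2⌉) ⟨
  2 * ⌈ n /2⌉             ∎
  where open ≤-Reasoning

⌊2*n/2⌋≡n : ∀ n → ⌊ 2 * n /2⌋ ≡ n
⌊2*n/2⌋≡n n = sym (trans (n≡⌊n+n/2⌋ n) (cong (λ t → ⌊ n + t /2⌋) (sym (+-identityʳ n))))

⌈2*n/2⌉≡n : ∀ n → ⌈ 2 * n /2⌉ ≡ n
⌈2*n/2⌉≡n n = sym (trans (n≡⌈n+n/2⌉ n) (cong (λ t → ⌈ n + t /2⌉) (sym (+-identityʳ n))))

2*m≤n⇒m≤⌊n/2⌋ : ∀ {m n} → 2 * m ≤ n → m ≤ ⌊ n /2⌋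
2*m≤n⇒m≤⌊n/2⌋ {m} 2m≤n = subst (_≤ _) (⌊2*n/2⌋≡n m) (⌊n/2⌋-mono 2m≤n)

2+2*m≤2*n : ∀ {m n} → m < n → 2 + 2 * m ≤ 2 * n
2+2*m≤2*n {m} {n} m<n = subst (_≤ 2 * n) (*-suc 2 m) (*-monoʳ-≤ 2 m<n)

⌊m/2⌋≡⌊n/2⌋⇒ : ∀ {m n} → ⌊ m /2⌋ ≡ ⌊ n /2⌋ → m ≡ n ⊎ n ≡ suc m ⊎ m ≡ suc n
⌊m/2⌋≡⌊n/2⌋⇒ {0} {0} _ = inj₁ refl
⌊m/2⌋≡⌊n/2⌋⇒ {0} {1} _ = inj₂ (inj₁ refl)
⌊m/2⌋≡⌊n/2⌋⇒ {1} {0} _ = inj₂ (inj₂ refl)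
⌊m/2⌋≡⌊n/2⌋⇒ {1} {1} _ = inj₁ refl
⌊m/2⌋≡⌊n/2⌋⇒ {0} {suc (suc n)} ()
⌊m/2⌋≡⌊n/2⌋⇒ {1} {suc (suc n)} ()
⌊m/2⌋≡⌊n/2⌋⇒ {suc (suc m)} {0} ()
⌊m/2⌋≡⌊n/2⌋⇒ {suc (suc m)} {1} ()
⌊m/2⌋≡⌊n/2⌋⇒ {suc (suc m)} {suc (suc n)} eq with ⌊m/2⌋≡⌊n/2⌋⇒ {m} {n} (suc-injective eq)
... | inj₁ m≡n = inj₁ (cong (λ t → suc (suc t)) m≡n)
... | inj₂ (inj₁ n≡1+m) = inj₂ (inj₁ (cong (λ t → suc (suc t)) n≡1+m))
... | inj₂ (inj₂ m≡1+n) = inj₂ (inj₂ (cong (λ t → suc (suc t)) m≡1+n))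

⌊2*m+n/2⌋≡m+⌊n/2⌋ : ∀ m n → ⌊ 2 * m + n /2⌋ ≡ m + ⌊ n /2⌋
⌊2*m+n/2⌋≡m+⌊n/2⌋ zero n = refl
⌊2*m+n/2⌋≡m+⌊n/2⌋ (suc m) n = trans (cong (λ t → ⌊ t + n /2⌋) (*-suc 2 m)) (cong suc (⌊2*m+n/2⌋≡m+⌊n/2⌋ m n))

%-injective-window : ∀ {X Y} n .{{_ : NonZero n}} → X < Y → Y < X + n → X % n ≢ Y % n
%-injective-window {X} {Y} n X<Y Y<X+n X%n≡Y%n = <-irrefl refl (<-≤-trans Y<X+n X+n≤Y)
  where
  open ≤-Reasoning
  X≡ : X ≡ X % n + X / n * n
  X≡ = m≡m%n+[m/n]*n X n
  Y≡ : Y ≡ X % n + Y / n * n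
  Y≡ = trans (m≡m%n+[m/n]*n Y n) (cong (_+ Y / n * n) (sym X%n≡Y%n))
  X/n<Y/n : X / n < Y / n
  X/n<Y/n = *-cancelʳ-< n (X / n) (Y / n) (+-cancelˡ-< (X % n) _ _ (subst₂ _<_ X≡ Y≡ X<Y))
  X+n≤Y : X + n ≤ Y
  X+n≤Y = begin
    X + n                      ≡⟨ cong (_+ n) X≡ ⟩
    X % n + X / n * n + n      ≡⟨ +-assoc (X % n) _ n ⟩
    X % n + (X / n * n + n)    ≡⟨ cong (X % n +_) (+-comm _ n) ⟩
    X % n + suc (X / n) * n    ≤⟨ +-monoʳ-≤ (X % n) (*-monoˡ-≤ n X/n<Y/n) ⟩
    X % n + Y / n * n          ≡⟨ Y≡ ⟨
    Y                          ∎

[1+m%n]%n≡[1+m]%n : ∀ m n .{{_ : NonZero n}} → suc (m % n) % n ≡ suc m % n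
[1+m%n]%n≡[1+m]%n m n = begin
  (1 + m % n) % n              ≡⟨ %-distribˡ-+ 1 (m % n) n ⟩
  (1 % n + m % n % n) % n      ≡⟨ cong (λ t → (1 % n + t) % n) (m%n%n≡m%n m n) ⟩
  (1 % n + m % n) % n          ≡⟨ %-distribˡ-+ 1 m n ⟨
  (1 + m) % n                  ∎
  where open ≡-Reasoning

[1+m]%[1+n]-cases : ∀ {m n} → m < suc n → (m < n × suc m % suc n ≡ suc m) ⊎ (m ≡ n × suc m % suc n ≡ 0)
[1+m]%[1+n]-cases {m} {n} m<1+n with suc m <? suc n
... | yes 1+m<1+n = inj₁ (≤-pred 1+m<1+n , m<n⇒m%n≡m 1+m<1+n)
... | no 1+m≮1+n = inj₂ (m≡n , trans (cong (λ t → suc t % suc n) m≡n) (n%n≡0 (suc n)))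
  where
  m≡n : m ≡ n
  m≡n = ≤-antisym (≤-pred m<1+n) (≤-pred (≮⇒≥ 1+m≮1+n))

m<2+n⇒m≢[1+m]%[2+n] : ∀ {m n} → m < suc (suc n) → m ≢ suc m % suc (suc n)
m<2+n⇒m≢[1+m]%[2+n] {m} {n} m<M m≡1+m%M with suc m <? suc (suc n)
... | yes 1+m<M = 1+n≢n (sym (trans m≡1+m%M (m<n⇒m%n≡m 1+m<M)))
... | no 1+m≮M = 1+n≢0 (suc-injective (trans (sym 1+m≡M) (cong suc m≡0)))
  where
  1+m≡M : suc m ≡ suc (suc n)
  1+m≡M = ≤-antisym m<M (≮⇒≥ 1+m≮M)
  m≡0 : m ≡ 0
  m≡0 = trans m≡1+m%M (trans (cong (_% suc (suc n)) 1+m≡M) (n%n≡0 (suc (suc n))))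

-- Independent sets

Independent : {A : Set} → (A → A → Set) → (A → Bool) → Set
Independent R S = ∀ x y → T (S x) → T (S y) → ¬ R x y

α≤ : ∀ {n} → Graph n → ℕ → Set
α≤ G a = ∀ S → Independent G S → size S ≤ a

IndependentOfSize : ∀ {n} → Graph n → ℕ → Set
IndependentOfSize G a = Σ _ λ S → Independent G S × size S ≡ a

IsIndependenceNumber : ∀ {n} → Graph n → ℕ → Set
IsIndependenceNumber G a = IndependentOfSize G a × α≤ G a

size₂ : ∀ {m n} → (Fin m × Fin n → Bool) → ℕ
size₂ {m} S = ∑[ g < m ] size (λ h → S (g , h))

α₂≤ : ∀ {m n} → (Fin m × Fin n → Fin m × Fin n → Set) → ℕ → Set
α₂≤ R a = ∀ S → Independent R S → size₂ S ≤ a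

IndependentOfSize₂ : ∀ {m n} → (Fin m × Fin n → Fin m × Fin n → Set) → ℕ → Set
IndependentOfSize₂ R a = Σ _ λ S → Independent R S × size₂ S ≡ a

CliqueCover : ∀ {n} → Graph n → ℕ → Set
CliqueCover {n} G c = Σ (Fin n → Fin c) λ κ → ∀ x y → κ x ≡ κ y → x ≡ y ⊎ G x y

size≤b*𝟙nonempty : ∀ {n} (S : Fin n → Bool) {b} → size S ≤ b → size S ≤ b * 𝟙 (nonempty S)
size≤b*𝟙nonempty S {b} S≤b with any? (T? ∘ S)
... | yes _ = subst (size S ≤_) (sym (*-identityʳ b)) S≤b
... | no ∄ = ≤-reflexive (trans (size-∅ S (λ x x∈S → ∄ (x , x∈S))) (sym (*-zeroʳ b)))

cliqueCover⇒α≤ : ∀ {n} {G : Graph n} {c} → CliqueCover G c → α≤ G c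
cliqueCover⇒α≤ {n} {G} {c} (κ , κ-clique) S S-ind = begin
  size S                                      ≡⟨ size-fibres S κ ⟩
  ∑[ q < c ] size (λ x → S x ∧ ⌊ κ x ≟ q ⌋)  ≤⟨ ∑-mono-≤ (λ q → size≤1 (fibre≤1 q)) ⟩
  ∑[ q < c ] 1                                ≡⟨ trans (∑-const c 1) (*-identityʳ c) ⟩
  c                                           ∎
  where
  open ≤-Reasoning
  fibre≤1 : ∀ q → AtMostOne (λ x → S x ∧ ⌊ κ x ≟ q ⌋)
  fibre≤1 q x y x∈ y∈ with Equivalence.to T-∧ x∈ | Equivalence.to T-∧ y∈
  ... | x∈S , κx≡q | y∈S , κy≡q with κ-clique x y (trans (toWitness κx≡q) (sym (toWitness κy≡q)))
  ... | inj₁ x≡y = x≡y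
  ... | inj₂ Gxy = ⊥-elim (S-ind x y x∈S y∈S Gxy)

-- Within the rows of one clique of the cover, an independent set has at most one vertex per column,
-- so its columns there form an independent set of H (the clique's shadow).
strong-α≤ : ∀ {m n} {G : Graph m} {H : Graph n} {c a} →
            CliqueCover G c → α≤ H a → α₂≤ (StrongRel G H) (c * a)
strong-α≤ {m} {n} {G} {H} {c} {a} (κ , κ-clique) α≤a S S-ind = begin
  size₂ S                                    ≡⟨ ∑-comm (λ g h → 𝟙 (S (g , h))) ⟩
  ∑[ h < n ] size (λ g → S (g , h))          ≡⟨ sum-cong-≗ {n} (λ h → size-fibres (λ g → S (g , h)) κ) ⟩
  ∑[ h < n ] ∑[ q < c ] size (cell q h)      ≡⟨ ∑-comm (λ h q → size (cell q h)) ⟩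
  ∑[ q < c ] ∑[ h < n ] size (cell q h)      ≡⟨ sum-cong-≗ {c} (λ q → sum-cong-≗ {n} (size≡𝟙nonempty ∘ cell≤1 q)) ⟩
  ∑[ q < c ] size (shadow q)                 ≤⟨ ∑-mono-≤ (λ q → α≤a (shadow q) (shadow-independent q)) ⟩
  ∑[ q < c ] a                               ≡⟨ ∑-const c a ⟩
  c * a                                      ∎
  where
  open ≤-Reasoning
  cell : Fin c → Fin n → Fin m → Bool
  cell q h g = S (g , h) ∧ ⌊ κ g ≟ q ⌋
  shadow : Fin c → Fin n → Bool
  shadow q h = nonempty (cell q h)
  same-clique : ∀ {q g g′ h h′} → T (cell q h g) → T (cell q h′ g′) →
               T (S (g , h)) × T (S (g′ , h′)) × (g ≡ g′ ⊎ G g g′)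
  same-clique {g = g} {g′} p p′ with Equivalence.to T-∧ p | Equivalence.to T-∧ p′
  ... | s , κg≡q | s′ , κg′≡q = s , s′ , κ-clique g g′ (trans (toWitness κg≡q) (sym (toWitness κg′≡q)))
  cell≤1 : ∀ q h → AtMostOne (cell q h)
  cell≤1 q h g g′ p p′ with same-clique p p′
  ... | _ , _ , inj₁ g≡g′ = g≡g′
  ... | s , s′ , inj₂ Ggg′ = ⊥-elim (S-ind (g , h) (g′ , h) s s′ (inj₁ (Ggg′ , refl)))
  shadow-independent : ∀ q → Independent H (shadow q)
  shadow-independent q h h′ p p′ Hhh′ with toWitness p | toWitness p′
  ... | g , c∈ | g′ , c′∈ with same-clique c∈ c′∈
  ... | s , s′ , inj₁ refl = S-ind (g , h) (g , h′) s s′ (inj₂ (inj₁ (refl , Hhh′)))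
  ... | s , s′ , inj₂ Ggg′ = S-ind (g , h) (g′ , h′) s s′ (inj₂ (inj₂ (Ggg′ , Hhh′)))

strong-α≤-swap : ∀ {m n} {G : Graph m} {H : Graph n} {a} → α₂≤ (StrongRel H G) a → α₂≤ (StrongRel G H) a
strong-α≤-swap {m} {n} {G} {H} α≤a S S-ind =
  subst (_≤ _) (∑-comm (λ h g → 𝟙 (S (g , h)))) (α≤a (S ∘ swap) swapped-independent)
  where
  swapped-independent : Independent (StrongRel H G) (S ∘ swap)
  swapped-independent (h , g) (h′ , g′) s s′ (inj₁ (Hhh′ , g≡g′)) = S-ind _ _ s s′ (inj₂ (inj₁ (g≡g′ , Hhh′)))
  swapped-independent (h , g) (h′ , g′) s s′ (inj₂ (inj₁ (h≡h′ , Ggg′))) = S-ind _ _ s s′ (inj₁ (Ggg′ , h≡h′))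
  swapped-independent (h , g) (h′ , g′) s s′ (inj₂ (inj₂ (Hhh′ , Ggg′))) = S-ind _ _ s s′ (inj₂ (inj₂ (Ggg′ , Hhh′)))

lex-α≤ : ∀ {m n} {G : Graph m} {H : Graph n} {a b} → α≤ G a → α≤ H b → α₂≤ (LexRel G H) (a * b)
lex-α≤ {m} {n} {G} {H} {a} {b} α≤a α≤b S S-ind = begin
  ∑[ g < m ] size (row g)                 ≤⟨ ∑-mono-≤ (λ g → size≤b*𝟙nonempty (row g) (α≤b _ (row-independent g))) ⟩
  ∑[ g < m ] (b * 𝟙 (nonempty (row g)))   ≡⟨ *-distribˡ-sum {m} b _ ⟨
  b * size (nonempty ∘ row)               ≤⟨ *-monoʳ-≤ b (α≤a (nonempty ∘ row) occupied-independent) ⟩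
  b * a                                   ≡⟨ *-comm b a ⟩
  a * b                                   ∎
  where
  open ≤-Reasoning
  row : Fin m → Fin n → Bool
  row g h = S (g , h)
  row-independent : ∀ g → Independent H (row g)
  row-independent g h h′ s s′ Hhh′ = S-ind (g , h) (g , h′) s s′ (inj₂ (refl , Hhh′))
  occupied-independent : Independent G (nonempty ∘ row)
  occupied-independent g g′ p p′ Ggg′ with toWitness p | toWitness p′
  ... | h , s | h′ , s′ = S-ind (g , h) (g′ , h′) s s′ (inj₁ Ggg′)

adjacent-rows≤ : ∀ {m n} {G : Graph m} {H : Graph n} {a} → Symmetric G → α≤ H a →
                 ∀ S → Independent (StrongRel G H) S → ∀ {g g′} → G g g′ →
                 size (λ h → S (g , h)) + size (λ h → S (g′ , h)) ≤ a
adjacent-rows≤ {n = n} {G} {H} {a} G-sym α≤a S S-ind {g} {g′} Ggg′ = begin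
  size (λ h → S (g , h)) + size (λ h → S (g′ , h))    ≡⟨ ∑-distrib-+ (λ h → 𝟙 (S (g , h))) (λ h → 𝟙 (S (g′ , h))) ⟨
  ∑[ h < n ] (𝟙 (S (g , h)) + 𝟙 (S (g′ , h)))          ≡⟨ sum-cong-≗ {n} (λ h → sym (𝟙-∨ _ _ (not-both h))) ⟩
  size union                                           ≤⟨ α≤a union union-independent ⟩
  a                                                    ∎
  where
  open ≤-Reasoning
  union : Fin n → Bool
  union h = S (g , h) ∨ S (g′ , h)
  not-both : ∀ h → ¬ (T (S (g , h)) × T (S (g′ , h)))
  not-both h (s , s′) = S-ind (g , h) (g′ , h) s s′ (inj₁ (Ggg′ , refl))
  union-independent : Independent H union
  union-independent h h′ p p′ Hhh′ with Equivalence.to T-∨ p | Equivalence.to T-∨ p′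
  ... | inj₁ s | inj₁ s′ = S-ind (g , h) (g , h′) s s′ (inj₂ (inj₁ (refl , Hhh′)))
  ... | inj₁ s | inj₂ s′ = S-ind (g , h) (g′ , h′) s s′ (inj₂ (inj₂ (Ggg′ , Hhh′)))
  ... | inj₂ s | inj₁ s′ = S-ind (g′ , h) (g , h′) s s′ (inj₂ (inj₂ (G-sym Ggg′ , Hhh′)))
  ... | inj₂ s | inj₂ s′ = S-ind (g′ , h) (g′ , h′) s s′ (inj₂ (inj₁ (refl , Hhh′)))

_⊗_ : ∀ {m n} → (Fin m → Bool) → (Fin n → Bool) → Fin m × Fin n → Bool
(A ⊗ B) (g , h) = A g ∧ B h

size₂-⊗ : ∀ {m n} (A : Fin m → Bool) (B : Fin n → Bool) → size₂ (A ⊗ B) ≡ size A * size B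
size₂-⊗ {m} {n} A B = begin
  ∑[ g < m ] ∑[ h < n ] 𝟙 (A g ∧ B h)        ≡⟨ sum-cong-≗ {m} (λ g → sum-cong-≗ {n} (λ h → 𝟙-∧ (A g) (B h))) ⟩
  ∑[ g < m ] ∑[ h < n ] (𝟙 (A g) * 𝟙 (B h))  ≡⟨ sum-cong-≗ {m} (λ g → *-distribˡ-sum {n} (𝟙 (A g)) (𝟙 ∘ B)) ⟨
  ∑[ g < m ] (𝟙 (A g) * size B)              ≡⟨ *-distribʳ-sum {m} (size B) (𝟙 ∘ A) ⟨
  size A * size B                            ∎
  where open ≡-Reasoning

module _ {m n} {G : Graph m} {H : Graph n} where

  strong-independentOfSize : ∀ {a b} → IndependentOfSize G a → IndependentOfSize H b →
                             IndependentOfSize₂ (StrongRel G H) (a * b)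
  strong-independentOfSize (A , A-ind , size-A) (B , B-ind , size-B) =
    A ⊗ B , independent , trans (size₂-⊗ A B) (cong₂ _*_ size-A size-B)
    where
    independent : Independent (StrongRel G H) (A ⊗ B)
    independent (g , h) (g′ , h′) p p′ edge with Equivalence.to T-∧ p | Equivalence.to T-∧ p′ | edge
    ... | a , _ | a′ , _ | inj₁ (Ggg′ , _) = A-ind g g′ a a′ Ggg′
    ... | _ , b | _ , b′ | inj₂ (inj₁ (_ , Hhh′)) = B-ind h h′ b b′ Hhh′
    ... | a , _ | a′ , _ | inj₂ (inj₂ (Ggg′ , _)) = A-ind g g′ a a′ Ggg′

  lex-independentOfSize : ∀ {a b} → IndependentOfSize G a → IndependentOfSize H b →
                          IndependentOfSize₂ (LexRel G H) (a * b)
  lex-independentOfSize (A , A-ind , size-A) (B , B-ind , size-B) =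
    A ⊗ B , independent , trans (size₂-⊗ A B) (cong₂ _*_ size-A size-B)
    where
    independent : Independent (LexRel G H) (A ⊗ B)
    independent (g , h) (g′ , h′) p p′ edge with Equivalence.to T-∧ p | Equivalence.to T-∧ p′ | edge
    ... | a , _ | a′ , _ | inj₁ Ggg′ = A-ind g g′ a a′ Ggg′
    ... | _ , b | _ , b′ | inj₂ (_ , Hhh′) = B-ind h h′ b b′ Hhh′

-- Cycle convexity

TriangleClosed : {A : Set} → Rel A 0ℓ → Pred A 0ℓ → Set
TriangleClosed R P = ∀ {u v w} → P u → P v → R u v → R w u → R w v → P w

EdgeGenerating : {A : Set} → Rel A 0ℓ → Set₁
EdgeGenerating R = ∀ P → TriangleClosed R P → ∀ {u v} → P u → P v → R u v → ∀ x → P x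

∈⇒T : ∀ {n} {S : Subset n} {x} → x ∈ S → T (lookup S x)
∈⇒T x∈S = Equivalence.from T-≡ ([]=⇒lookup x∈S)

T⇒∈ : ∀ {n} {S : Subset n} {x} → T (lookup S x) → x ∈ S
T⇒∈ {S = S} {x} t = lookup⇒[]= x S (Equivalence.to T-≡ t)

∣∣≡size : ∀ {n} (S : Subset n) → ∣ S ∣ ≡ size (lookup S)
∣∣≡size [] = refl
∣∣≡size (true ∷ S) = cong suc (∣∣≡size S)
∣∣≡size (false ∷ S) = ∣∣≡size S

independent⇒convex : ∀ {n} {G : Graph n} {S : Subset n} → Independent G (lookup S) → Convex G S
independent⇒convex {S = S} S-ind w (_ , f , f-inj , f₀≡w , f∈ , steps , _) =
  ⊥-elim (S-ind (f 1F) (f 2F) (∈⇒T (∈S 1F λ ())) (∈⇒T (∈S 2F λ ())) (steps 1F))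
  where
  ∈S : ∀ i → i ≢ zero → f i ∈ S
  ∈S i i≢0 with x∈p∪q⁻ S _ (f∈ i)
  ... | inj₁ fi∈S = fi∈S
  ... | inj₂ fi≡w = ⊥-elim (i≢0 (f-inj (trans (x∈⁅y⁆⇒x≡y w fi≡w) (sym f₀≡w))))

convex⇒triangleClosed : ∀ {n} {G : Graph n} {S : Subset n} → Symmetric G → Irreflexive _≡_ G →
                        Convex G S → TriangleClosed G (_∈ S)
convex⇒triangleClosed {n} {G} {S} G-sym G-irr S-convex {u} {v} {w} u∈S v∈S Guv Gwu Gwv =
  S-convex w (0 , triangle , triangle-injective , refl , triangle-∈ , triangle-steps , G-sym Gwv)
  where
  triangle : Fin 3 → Fin n
  triangle 0F = w
  triangle 1F = u
  triangle 2F = v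
  triangle-injective : Injective _≡_ _≡_ triangle
  triangle-injective {0F} {0F} _ = refl
  triangle-injective {0F} {1F} w≡u = ⊥-elim (G-irr w≡u Gwu)
  triangle-injective {0F} {2F} w≡v = ⊥-elim (G-irr w≡v Gwv)
  triangle-injective {1F} {0F} u≡w = ⊥-elim (G-irr (sym u≡w) Gwu)
  triangle-injective {1F} {1F} _ = refl
  triangle-injective {1F} {2F} u≡v = ⊥-elim (G-irr u≡v Guv)
  triangle-injective {2F} {0F} v≡w = ⊥-elim (G-irr (sym v≡w) Gwv)
  triangle-injective {2F} {1F} v≡u = ⊥-elim (G-irr (sym v≡u) Guv)
  triangle-injective {2F} {2F} _ = refl
  triangle-∈ : ∀ i → triangle i ∈ S ∪ ⁅ w ⁆
  triangle-∈ 0F = x∈p∪q⁺ (inj₂ (x∈⁅x⁆ w))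
  triangle-∈ 1F = x∈p∪q⁺ (inj₁ u∈S)
  triangle-∈ 2F = x∈p∪q⁺ (inj₁ v∈S)
  triangle-steps : ∀ (i : Fin 2) → G (triangle (inject₁ i)) (triangle (suc i))
  triangle-steps 0F = Gwu
  triangle-steps 1F = Guv

proper-convex⇒independent : ∀ {n} {G : Graph n} {S : Subset n} → Symmetric G → Irreflexive _≡_ G →
                            EdgeGenerating G → Convex G S → S ≢ ⊤ → Independent G (lookup S)
proper-convex⇒independent {S = S} G-sym G-irr G-gen S-convex S≢⊤ x y x∈S y∈S Gxy =
  S≢⊤ (⊆-antisym ⊆⊤ (λ {z} _ → G-gen (_∈ S) (convex⇒triangleClosed G-sym G-irr S-convex) (T⇒∈ x∈S) (T⇒∈ y∈S) Gxy z))

isCcc-of-α : ∀ {n} {G : Graph n} {c} → Symmetric G → Irreflexive _≡_ G → EdgeGenerating G → ∃₂ G →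
             IsIndependenceNumber G c → IsCcc G c
isCcc-of-α {n} {G} {c} G-sym G-irr G-gen (u , v , Guv) ((S , S-ind , size-S) , α≤c) =
  (tabulate S , independent⇒convex tabulate-independent , proper , size-tabulate) ,
  λ S′ S′-convex S′≢⊤ → subst (_≤ c) (sym (∣∣≡size S′))
                          (α≤c (lookup S′) (proper-convex⇒independent G-sym G-irr G-gen S′-convex S′≢⊤))
  where
  tabulate-independent : Independent G (lookup (tabulate S))
  tabulate-independent x y p q =
    S-ind x y (subst T (lookup∘tabulate S x) p) (subst T (lookup∘tabulate S y) q)
  proper : tabulate S ≢ ⊤
  proper S≡⊤ = tabulate-independent u v (∈⇒T (subst (u ∈_) (sym S≡⊤) ∈⊤)) (∈⇒T (subst (v ∈_) (sym S≡⊤) ∈⊤)) Guv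
  size-tabulate : ∣ tabulate S ∣ ≡ c
  size-tabulate = trans (∣∣≡size (tabulate S)) (trans (sum-cong-≗ {n} (cong 𝟙 ∘ lookup∘tabulate S)) size-S)

module _ {m n} {R : Rel (Fin m × Fin n) 0ℓ} where

  private
    lift : ∀ {p q} → R p q → (R on remQuot n) (uncurry combine p) (uncurry combine q)
    lift {g , h} {g′ , h′} = subst₂ R (sym (remQuot-combine g h)) (sym (remQuot-combine g′ h′))

  on-remQuot-edgeGenerating : EdgeGenerating R → EdgeGenerating (R on remQuot n)
  on-remQuot-edgeGenerating R-gen P P-closed {u} {v} Pu Pv Ruv x =
    subst P (combine-remQuot {m} n x) (R-gen (P ∘ uncurry combine) pulled-back (back Pu) (back Pv) Ruv (remQuot n x))
    where
    back : ∀ {y : Fin (m * n)} → P y → P (uncurry combine (remQuot {m} n y))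
    back {y} = subst P (sym (combine-remQuot {m} n y))
    pulled-back : TriangleClosed R (P ∘ uncurry combine)
    pulled-back Pu Pv Ruv Rwu Rwv = P-closed Pu Pv (lift Ruv) (lift Rwu) (lift Rwv)

  on-remQuot-isIndependenceNumber : ∀ {c} → IndependentOfSize₂ R c → α₂≤ R c →
                                    IsIndependenceNumber (R on remQuot n) c
  on-remQuot-isIndependenceNumber {c} (S , S-ind , size-S) α≤c =
    (S ∘ remQuot n , (λ x y → S-ind (remQuot n x) (remQuot n y)) , size-pulled-back) ,
    λ S′ S′-ind → subst (_≤ c) (sym (∑-combine m n (𝟙 ∘ S′)))
                    (α≤c (S′ ∘ uncurry combine) (λ p q s s′ → S′-ind _ _ s s′ ∘ lift))
    where
    size-pulled-back : size (S ∘ remQuot n) ≡ c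
    size-pulled-back = trans (∑-combine m n (𝟙 ∘ S ∘ remQuot n))
      (trans (sum-cong-≗ {m} (λ g → sum-cong-≗ {n} (λ h → cong (𝟙 ∘ S) (remQuot-combine g h)))) size-S)

  on-remQuot-isCcc : ∀ {c} → Symmetric R → Irreflexive _≡_ R → EdgeGenerating R → ∃₂ R →
                     IndependentOfSize₂ R c → α₂≤ R c → IsCcc (R on remQuot n) c
  on-remQuot-isCcc R-sym R-irr R-gen (p , q , Rpq) witness α≤c =
    isCcc-of-α R-sym (R-irr ∘ cong (remQuot {m} n)) (on-remQuot-edgeGenerating R-gen)
      (uncurry combine p , uncurry combine q , lift Rpq) (on-remQuot-isIndependenceNumber witness α≤c)

-- Connected graphs and their products

Connected : ∀ {n} → Graph n → Set₁
Connected {n} G = ∀ (P : Pred (Fin n) 0ℓ) → (∀ {x y} → G x y → P x → P y) → ∀ {x} → P x → ∀ y → P y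

record IsConnectedGraph {n} (G : Graph n) : Set₁ where
  field
    symmetric   : Symmetric G
    irreflexive : Irreflexive _≡_ G
    connected   : Connected G
    edge        : ∃₂ G

  neighbour : ∀ x → ∃ (G x)
  neighbour = connected (∃ ∘ G) (λ Gxy _ → _ , symmetric Gxy) (proj₂ edge)

Connected-mono : ∀ {n} {G G′ : Graph n} → (∀ {x y} → G x y → G′ x y) → Connected G → Connected G′
Connected-mono G⊆G′ G-conn Q step = G-conn Q (step ∘ G⊆G′)

module _ {m n} {G : Graph m} {H : Graph n} (G-conn : IsConnectedGraph G) (H-conn : IsConnectedGraph H) where

  private
    module G = IsConnectedGraph G-conn
    module H = IsConnectedGraph H-conn

  private
    horizontal : ∀ {g g′ h} → G g g′ → StrongRel G H (g , h) (g′ , h)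
    horizontal Ggg′ = inj₁ (Ggg′ , refl)

    vertical : ∀ {g h h′} → H h h′ → StrongRel G H (g , h) (g , h′)
    vertical Hhh′ = inj₂ (inj₁ (refl , Hhh′))

    diagonal : ∀ {g g′ h h′} → G g g′ → H h h′ → StrongRel G H (g , h) (g′ , h′)
    diagonal Ggg′ Hhh′ = inj₂ (inj₂ (Ggg′ , Hhh′))

  strong-sym : Symmetric (StrongRel G H)
  strong-sym (inj₁ (Ggg′ , refl)) = horizontal (G.symmetric Ggg′)
  strong-sym (inj₂ (inj₁ (refl , Hhh′))) = vertical (H.symmetric Hhh′)
  strong-sym (inj₂ (inj₂ (Ggg′ , Hhh′))) = diagonal (G.symmetric Ggg′) (H.symmetric Hhh′)

  strong-irrefl : Irreflexive _≡_ (StrongRel G H)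
  strong-irrefl refl (inj₁ (Ggg , _)) = G.irreflexive refl Ggg
  strong-irrefl refl (inj₂ (inj₁ (_ , Hhh))) = H.irreflexive refl Hhh
  strong-irrefl refl (inj₂ (inj₂ (Ggg , _))) = G.irreflexive refl Ggg

  strong-edge : ∃₂ (StrongRel G H)
  strong-edge with G.edge | H.edge
  ... | g , g′ , Ggg′ | h , _ = (g , h) , (g′ , h) , horizontal Ggg′

  -- A triangle-closed set containing an edge contains a square {g, g′} × {h, h′}, which is a K₄;
  -- such squares slide along the edges of either factor.
  strong-edgeGenerating : EdgeGenerating (StrongRel G H)
  strong-edgeGenerating P P-closed Pu Pv Ruv (a , b) = fill (initial Pu Pv Ruv)
    where
    Square : Fin m → Fin m → Fin n → Fin n → Set
    Square g g′ h h′ = G g g′ × H h h′ × P (g , h) × P (g , h′) × P (g′ , h) × P (g′ , h′)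

    stepG : ∀ {g g′ g″ h h′} → Square g g′ h h′ → G g′ g″ → Square g′ g″ h h′
    stepG (_ , Hhh′ , _ , _ , Pg′h , Pg′h′) Gg′g″ = Gg′g″ , Hhh′ , Pg′h , Pg′h′ ,
      P-closed Pg′h Pg′h′ (vertical Hhh′) (horizontal Gg″g′) (diagonal Gg″g′ Hhh′) ,
      P-closed Pg′h′ Pg′h (vertical Hh′h) (horizontal Gg″g′) (diagonal Gg″g′ Hh′h)
      where
      Gg″g′ = G.symmetric Gg′g″
      Hh′h = H.symmetric Hhh′

    stepH : ∀ {g g′ h h′ h″} → Square g g′ h h′ → H h′ h″ → Square g g′ h′ h″
    stepH (Ggg′ , _ , _ , Pgh′ , _ , Pg′h′) Hh′h″ = Ggg′ , Hh′h″ , Pgh′ ,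
      P-closed Pgh′ Pg′h′ (horizontal Ggg′) (vertical Hh″h′) (diagonal Ggg′ Hh″h′) ,
      Pg′h′ ,
      P-closed Pg′h′ Pgh′ (horizontal Gg′g) (vertical Hh″h′) (diagonal Gg′g Hh″h′)
      where
      Gg′g = G.symmetric Ggg′
      Hh″h′ = H.symmetric Hh′h″

    initial : ∀ {u v} → P u → P v → StrongRel G H u v → ∃₂ λ g g′ → ∃₂ λ h h′ → Square g g′ h h′
    initial {g , h} {g′ , _} Pu Pv (inj₁ (Ggg′ , refl)) with H.neighbour h
    ... | h′ , Hhh′ = g , g′ , h , h′ , Ggg′ , Hhh′ , Pu ,
      P-closed Pu Pv (horizontal Ggg′) (vertical (H.symmetric Hhh′)) (diagonal Ggg′ (H.symmetric Hhh′)) , Pv ,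
      P-closed Pu Pv (horizontal Ggg′) (diagonal (G.symmetric Ggg′) (H.symmetric Hhh′)) (vertical (H.symmetric Hhh′))
    initial {g , h} {_ , h′} Pu Pv (inj₂ (inj₁ (refl , Hhh′))) with G.neighbour g
    ... | g′ , Ggg′ = g , g′ , h , h′ , Ggg′ , Hhh′ , Pu , Pv ,
      P-closed Pu Pv (vertical Hhh′) (horizontal (G.symmetric Ggg′)) (diagonal (G.symmetric Ggg′) Hhh′) ,
      P-closed Pu Pv (vertical Hhh′) (diagonal (G.symmetric Ggg′) (H.symmetric Hhh′)) (horizontal (G.symmetric Ggg′))
    initial {g , h} {g′ , h′} Pu Pv (inj₂ (inj₂ (Ggg′ , Hhh′))) = g , g′ , h , h′ , Ggg′ , Hhh′ , Pu ,
      P-closed Pu Pv (diagonal Ggg′ Hhh′) (vertical (H.symmetric Hhh′)) (horizontal Ggg′) ,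
      P-closed Pu Pv (diagonal Ggg′ Hhh′) (horizontal (G.symmetric Ggg′)) (vertical Hhh′) , Pv

    fill : (∃₂ λ g g′ → ∃₂ λ h h′ → Square g g′ h h′) → P (a , b)
    fill (g₀ , g₁ , h₀ , h₁ , square₀) = corner (proj₂ columnᵦ)
      where
      corner : ∀ {g g′ h h′} → Square g g′ h h′ → P (g′ , h′)
      corner (_ , _ , _ , _ , _ , Pg′h′) = Pg′h′
      rowₐ : ∃ λ g → Square g a h₀ h₁
      rowₐ = G.connected (λ g′ → ∃ λ g → Square g g′ h₀ h₁) (λ Gg′g″ (_ , sq) → _ , stepG sq Gg′g″)
               (g₀ , square₀) a
      columnᵦ : ∃ λ h → Square (proj₁ rowₐ) a h b
      columnᵦ = H.connected (λ h′ → ∃ λ h → Square (proj₁ rowₐ) a h h′) (λ Hh′h″ (_ , sq) → _ , stepH sq Hh′h″)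
                  (h₀ , proj₂ rowₐ) b

  lex-sym : Symmetric (LexRel G H)
  lex-sym (inj₁ Ggg′) = inj₁ (G.symmetric Ggg′)
  lex-sym (inj₂ (refl , Hhh′)) = inj₂ (refl , H.symmetric Hhh′)

  lex-irrefl : Irreflexive _≡_ (LexRel G H)
  lex-irrefl refl (inj₁ Ggg) = G.irreflexive refl Ggg
  lex-irrefl refl (inj₂ (_ , Hhh)) = H.irreflexive refl Hhh

  lex-edge : ∃₂ (LexRel G H)
  lex-edge with G.edge | H.edge
  ... | g , g′ , Ggg′ | h , _ = (g , h) , (g′ , h) , inj₁ Ggg′

  -- An edge inside one fibre makes every neighbouring fibre full, and a full fibre does the same.
  lex-edgeGenerating : EdgeGenerating (LexRel G H)
  lex-edgeGenerating P P-closed Pu Pv Ruv (a , b) = fullₐ b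
    where
    Full : Pred (Fin m) 0ℓ
    Full g = ∀ h → P (g , h)

    neighbour-full : ∀ {g g′ h h′} → H h h′ → P (g , h) → P (g , h′) → G g′ g → Full g′
    neighbour-full Hhh′ Pgh Pgh′ Gg′g _ = P-closed Pgh Pgh′ (inj₂ (refl , Hhh′)) (inj₁ Gg′g) (inj₁ Gg′g)

    fibre-edge : ∀ {u v} → P u → P v → LexRel G H u v → ∃₂ λ g h → ∃ λ h′ → H h h′ × P (g , h) × P (g , h′)
    fibre-edge {g , h} {g′ , h′} Pu Pv (inj₁ Ggg′) with H.neighbour h′
    ... | h″ , Hh′h″ = g′ , h′ , h″ , Hh′h″ , Pv ,
      P-closed Pv Pu (inj₁ (G.symmetric Ggg′)) (inj₂ (refl , H.symmetric Hh′h″)) (inj₁ (G.symmetric Ggg′))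
    fibre-edge {g , h} {_ , h′} Pu Pv (inj₂ (refl , Hhh′)) = g , h , h′ , Hhh′ , Pu , Pv

    some-full : ∃ Full
    some-full with fibre-edge Pu Pv Ruv
    ... | g , _ , _ , Hhh′ , Pgh , Pgh′ with G.neighbour g
    ... | g′ , Ggg′ = g′ , neighbour-full Hhh′ Pgh Pgh′ (G.symmetric Ggg′)

    full-step : ∀ {g g′} → G g g′ → Full g → Full g′
    full-step Ggg′ full with H.edge
    ... | h , h′ , Hhh′ = neighbour-full Hhh′ (full h) (full h′) (G.symmetric Ggg′)

    fullₐ : Full a
    fullₐ = G.connected Full full-step (proj₂ some-full) a

  strong-isCcc : ∀ {c} → IndependentOfSize₂ (StrongRel G H) c → α₂≤ (StrongRel G H) c → IsCcc (G ⊠ H) c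
  strong-isCcc = on-remQuot-isCcc strong-sym strong-irrefl strong-edgeGenerating strong-edge

  lex-isCcc : ∀ {c} → IndependentOfSize₂ (LexRel G H) c → α₂≤ (LexRel G H) c → IsCcc (G ⊙ H) c
  lex-isCcc = on-remQuot-isCcc lex-sym lex-irrefl lex-edgeGenerating lex-edge

  strong-isCcc-coverˡ : ∀ {a b} → CliqueCover G a → IndependentOfSize G a → IsIndependenceNumber H b →
                        IsCcc (G ⊠ H) (a * b)
  strong-isCcc-coverˡ cover witness (witnessH , α≤b) =
    strong-isCcc (strong-independentOfSize witness witnessH) (strong-α≤ cover α≤b)

  strong-isCcc-coverʳ : ∀ {a b} → IsIndependenceNumber G a → CliqueCover H b → IndependentOfSize H b →
                        IsCcc (G ⊠ H) (a * b)
  strong-isCcc-coverʳ {a} {b} (witnessG , α≤a) cover witness =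
    strong-isCcc (strong-independentOfSize witnessG witness)
      (subst (α₂≤ (StrongRel G H)) (*-comm b a) (strong-α≤-swap (strong-α≤ cover α≤a)))

  lex-isCcc-α : ∀ {a b} → IsIndependenceNumber G a → IsIndependenceNumber H b → IsCcc (G ⊙ H) (a * b)
  lex-isCcc-α (witnessG , α≤a) (witnessH , α≤b) =
    lex-isCcc (lex-independentOfSize witnessG witnessH) (lex-α≤ α≤a α≤b)

-- Paths, cycles and complete graphs

P-suc : ∀ {n} {x y : Fin n} → P n x y → P (suc n) (suc x) (suc y)
P-suc (inj₁ e) = inj₁ (cong suc e)
P-suc (inj₂ e) = inj₂ (cong suc e)

P-sym : ∀ {n} → Symmetric (P n)
P-sym (inj₁ e) = inj₂ e
P-sym (inj₂ e) = inj₁ e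

P-irrefl : ∀ {n} → Irreflexive _≡_ (P n)
P-irrefl refl (inj₁ e) = 1+n≢n (sym e)
P-irrefl refl (inj₂ e) = 1+n≢n (sym e)

P-connected : ∀ {n} → Connected (P (suc n))
P-connected Q step {x} Qx y = from-zero Q step (to-zero Q step x Qx) y
  where
  to-zero : ∀ {n} (Q : Pred (Fin (suc n)) 0ℓ) → (∀ {x y} → P (suc n) x y → Q x → Q y) → ∀ x → Q x → Q zero
  to-zero Q step zero Qx = Qx
  to-zero {suc n} Q step (suc x) Qx = step (inj₂ refl) (to-zero (Q ∘ suc) (step ∘ P-suc) x Qx)
  from-zero : ∀ {n} (Q : Pred (Fin (suc n)) 0ℓ) → (∀ {x y} → P (suc n) x y → Q x → Q y) → Q zero → ∀ y → Q y
  from-zero Q step Q₀ zero = Q₀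
  from-zero {suc n} Q step Q₀ (suc y) = from-zero (Q ∘ suc) (step ∘ P-suc) (step (inj₁ refl) Q₀) y

spanningPath⇒isConnectedGraph : ∀ {n} {G : Graph (suc (suc n))} → Symmetric G → Irreflexive _≡_ G →
                                (∀ {x y} → P _ x y → G x y) → IsConnectedGraph G
spanningPath⇒isConnectedGraph G-sym G-irr P⊆G = record
  { symmetric = G-sym ; irreflexive = G-irr ; connected = Connected-mono P⊆G P-connected
  ; edge = zero , suc zero , P⊆G (inj₁ refl) }

P⊆K : ∀ {n} {x y : Fin n} → P n x y → K n x y
P⊆K p refl = P-irrefl refl p

P⊆C : ∀ {n} {x y : Fin n} → P n x y → C n x y
P⊆C {suc n} {x} {y} (inj₁ e) = inj₁ (trans e (sym (m<n⇒m%n≡m (subst (_< suc n) e (Finₚ.toℕ<n y)))))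
P⊆C {suc n} {x} {y} (inj₂ e) = inj₂ (trans e (sym (m<n⇒m%n≡m (subst (_< suc n) e (Finₚ.toℕ<n x)))))

C-sym : ∀ {n} {x y : Fin n} → C n x y → C n y x
C-sym {suc n} (inj₁ e) = inj₂ e
C-sym {suc n} (inj₂ e) = inj₁ e

C-next : ∀ {n} (i : Fin (suc n)) → C (suc n) i (next i)
C-next i = inj₁ (toℕ-fromℕ< _)

C-irrefl : ∀ {n} → Irreflexive _≡_ (C (suc (suc n)))
C-irrefl {x = x} refl (inj₁ e) = m<2+n⇒m≢[1+m]%[2+n] (Finₚ.toℕ<n x) e
C-irrefl {x = x} refl (inj₂ e) = m<2+n⇒m≢[1+m]%[2+n] (Finₚ.toℕ<n x) e

K-isConnectedGraph : ∀ {n} → 2 ≤ n → IsConnectedGraph (K n)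
K-isConnectedGraph (s≤s (s≤s _)) = spanningPath⇒isConnectedGraph (_∘ sym) (λ x≡y x≢y → x≢y x≡y) P⊆K

P-isConnectedGraph : ∀ {n} → 2 ≤ n → IsConnectedGraph (P n)
P-isConnectedGraph (s≤s (s≤s _)) = spanningPath⇒isConnectedGraph P-sym P-irrefl (λ p → p)

C-isConnectedGraph : ∀ {n} → 2 ≤ n → IsConnectedGraph (C n)
C-isConnectedGraph (s≤s (s≤s _)) = spanningPath⇒isConnectedGraph C-sym C-irrefl P⊆C

evens : ∀ ℓ {n} → 2 * ℓ ≤ suc n → Fin ℓ → Fin n
evens _ 2ℓ≤1+n i = fromℕ< (≤-pred (≤-trans (2+2*m≤2*n (Finₚ.toℕ<n i)) 2ℓ≤1+n))

evens-injective : ∀ ℓ {n} (2ℓ≤1+n : 2 * ℓ ≤ suc n) → Injective _≡_ _≡_ (evens ℓ 2ℓ≤1+n)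
evens-injective _ _ {i} {j} eq =
  toℕ-injective (*-cancelˡ-≡ (toℕ i) (toℕ j) 2 (trans (sym (toℕ-fromℕ< _)) (trans (cong toℕ eq) (toℕ-fromℕ< _))))

evens-apart : ∀ ℓ {n} (2ℓ≤1+n : 2 * ℓ ≤ suc n) {x y} → T (image (evens ℓ 2ℓ≤1+n) x) → T (image (evens ℓ 2ℓ≤1+n) y) →
              toℕ y ≢ suc (toℕ x)
evens-apart ℓ 2ℓ≤1+n {x} {y} x∈ y∈ y≡1+x with image-preimage (evens ℓ 2ℓ≤1+n) x∈ | image-preimage (evens ℓ 2ℓ≤1+n) y∈
... | i , evens-i≡x | j , evens-j≡y = even≢odd (toℕ j) (toℕ i) (begin
  2 * toℕ j                  ≡⟨ toℕ-fromℕ< _ ⟨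
  toℕ (evens ℓ 2ℓ≤1+n j)       ≡⟨ cong toℕ evens-j≡y ⟩
  toℕ y                      ≡⟨ y≡1+x ⟩
  suc (toℕ x)                ≡⟨ cong (suc ∘ toℕ) evens-i≡x ⟨
  suc (toℕ (evens ℓ 2ℓ≤1+n i)) ≡⟨ cong suc (toℕ-fromℕ< _) ⟩
  suc (2 * toℕ i)            ∎)
  where open ≡-Reasoning

evens-size : ∀ ℓ {n} (2ℓ≤1+n : 2 * ℓ ≤ suc n) → size (image (evens ℓ 2ℓ≤1+n)) ≡ ℓ
evens-size ℓ 2ℓ≤1+n = size-image (evens ℓ 2ℓ≤1+n) (evens-injective ℓ 2ℓ≤1+n)

pairCover : ∀ {n c} {G : Graph n} → n ≤ 2 * c → (∀ {x y} → P n x y → G x y) → CliqueCover G c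
pairCover {n} {c} {G} n≤2c P⊆G = pair , same-pair
  where
  pair : Fin n → Fin c
  pair x = fromℕ< (*-cancelˡ-< 2 ⌊ toℕ x /2⌋ c (<-≤-trans (≤-<-trans (2*⌊n/2⌋≤n (toℕ x)) (Finₚ.toℕ<n x)) n≤2c))
  same-pair : ∀ x y → pair x ≡ pair y → x ≡ y ⊎ G x y
  same-pair x y eq with ⌊m/2⌋≡⌊n/2⌋⇒ (trans (sym (toℕ-fromℕ< _)) (trans (cong toℕ eq) (toℕ-fromℕ< _)))
  ... | inj₁ x≡y = inj₁ (toℕ-injective x≡y)
  ... | inj₂ (inj₁ e) = inj₂ (P⊆G (inj₁ e))
  ... | inj₂ (inj₂ e) = inj₂ (P⊆G (inj₂ e))

K-cover : ∀ {n} → CliqueCover (K n) 1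
K-cover = (λ _ → zero) , λ x y _ → toSum (x ≟ y)

P-cover : ∀ {n} → CliqueCover (P n) ⌈ n /2⌉
P-cover {n} = pairCover (n≤2*⌈n/2⌉ n) (λ p → p)

K-α : ∀ {n} → IsIndependenceNumber (K (suc n)) 1
K-α {n} = ((λ x → ⌊ zero ≟ x ⌋) , independent , ∑-δ {suc n} zero) , cliqueCover⇒α≤ K-cover
  where
  independent : Independent (K _) (λ x → ⌊ zero ≟ x ⌋)
  independent x y x∈ y∈ x≢y = x≢y (trans (sym (toWitness x∈)) (toWitness y∈))

P-α : ∀ {n} → IsIndependenceNumber (P n) ⌈ n /2⌉
P-α {n} = (image (evens ⌈ n /2⌉ 2c≤1+n) , independent , evens-size ⌈ n /2⌉ 2c≤1+n) , cliqueCover⇒α≤ P-cover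
  where
  2c≤1+n : 2 * ⌈ n /2⌉ ≤ suc n
  2c≤1+n = 2*⌊n/2⌋≤n (suc n)
  independent : Independent (P n) (image (evens ⌈ n /2⌉ 2c≤1+n))
  independent x y x∈ y∈ (inj₁ e) = evens-apart ⌈ n /2⌉ 2c≤1+n x∈ y∈ e
  independent x y x∈ y∈ (inj₂ e) = evens-apart ⌈ n /2⌉ 2c≤1+n y∈ x∈ e

C-α≤ : ∀ n → α≤ (C (suc n)) ⌊ suc n /2⌋
C-α≤ n S S-ind = 2*m≤n⇒m≤⌊n/2⌋ (subst (2 * size S ≤_) (*-identityʳ (suc n))
  (cycle-double-count (𝟙 ∘ S) 1 (λ i → ≤-trans (≤-reflexive (sym (𝟙-∨ _ _ (not-both i)))) (𝟙≤1 _))))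
  where
  not-both : ∀ i → ¬ (T (S i) × T (S (next i)))
  not-both i (s , s′) = S-ind i (next i) s s′ (C-next i)

C-α : ∀ {n} → IsIndependenceNumber (C (suc n)) ⌊ suc n /2⌋
C-α {n} = (image (evens ⌊ suc n /2⌋ 2f≤1+n) , independent , evens-size ⌊ suc n /2⌋ 2f≤1+n) , C-α≤ n
  where
  2f≤1+n : 2 * ⌊ suc n /2⌋ ≤ suc (suc n)
  2f≤1+n = m≤n⇒m≤1+n (2*⌊n/2⌋≤n (suc n))
  no-wrap : ∀ {x} → T (image (evens ⌊ suc n /2⌋ 2f≤1+n) x) → suc (toℕ x) % suc n ≡ suc (toℕ x)
  no-wrap {x} x∈ with image-preimage (evens ⌊ suc n /2⌋ 2f≤1+n) x∈
  ... | i , evens-i≡x = m<n⇒m%n≡m (begin-strict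
    suc (toℕ x)                  ≡⟨ cong (suc ∘ toℕ) evens-i≡x ⟨
    suc (toℕ (evens ⌊ suc n /2⌋ 2f≤1+n i))   ≡⟨ cong suc (toℕ-fromℕ< _) ⟩
    suc (2 * toℕ i)              <⟨ 2+2*m≤2*n (Finₚ.toℕ<n i) ⟩
    2 * ⌊ suc n /2⌋              ≤⟨ 2*⌊n/2⌋≤n (suc n) ⟩
    suc n                        ∎)
    where open ≤-Reasoning
  independent : Independent (C (suc n)) (image (evens ⌊ suc n /2⌋ 2f≤1+n))
  independent x y x∈ y∈ (inj₁ e) = evens-apart ⌊ suc n /2⌋ 2f≤1+n x∈ y∈ (trans e (no-wrap x∈))
  independent x y x∈ y∈ (inj₂ e) = evens-apart ⌊ suc n /2⌋ 2f≤1+n y∈ x∈ (trans e (no-wrap y∈))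

strong-cycle-bound : ∀ {m n} {H : Graph n} {a} → α≤ H a →
                     ∀ S → Independent (StrongRel (C (suc m)) H) S → 2 * size₂ S ≤ suc m * a
strong-cycle-bound {m} α≤a S S-ind = cycle-double-count (λ g → size (λ h → S (g , h))) _
  (λ g → adjacent-rows≤ {G = C (suc m)} (C-sym {suc m}) α≤a S S-ind (C-next g))

-- Staircases

Close : ∀ {n} → Fin n → Fin n → Set
Close {n} x y = x ≡ y ⊎ C n x y

Close-sym : ∀ {n} {x y : Fin n} → Close x y → Close y x
Close-sym (inj₁ x≡y) = inj₁ (sym x≡y)
Close-sym (inj₂ Cxy) = inj₂ (C-sym Cxy)

residues-apart : ∀ {n X Y} {x y : Fin (suc n)} → 2 + X ≤ Y → 2 + Y ≤ X + suc n →
                 toℕ x ≡ X % suc n → toℕ y ≡ Y % suc n → ¬ Close x y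
residues-apart {n} {X} {Y} 2+X≤Y 2+Y≤X+M x≡X y≡Y (inj₁ refl) =
  %-injective-window (suc n) (≤-trans (n≤1+n _) 2+X≤Y) (≤-trans (n≤1+n _) 2+Y≤X+M) (trans (sym x≡X) y≡Y)
residues-apart {n} {X} {Y} 2+X≤Y 2+Y≤X+M x≡X y≡Y (inj₂ (inj₁ y≡1+x)) =
  %-injective-window (suc n) 2+X≤Y (≤-trans (n≤1+n _) (≤-trans 2+Y≤X+M (n≤1+n _)))
    (sym (trans (sym y≡Y) (trans y≡1+x (trans (cong (λ t → suc t % suc n) x≡X) ([1+m%n]%n≡[1+m]%n X (suc n))))))
residues-apart {n} {X} {Y} 2+X≤Y 2+Y≤X+M x≡X y≡Y (inj₂ (inj₂ x≡1+y)) =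
  %-injective-window (suc n) (s≤s (≤-trans (n≤1+n X) (≤-trans (n≤1+n _) 2+X≤Y))) 2+Y≤X+M
    (trans (sym x≡X) (trans x≡1+y (trans (cong (λ t → suc t % suc n) y≡Y) ([1+m%n]%n≡[1+m]%n Y (suc n)))))

record Run : Set where
  constructor mkRun
  field
    first  : ℕ
    length : ℕ

open Run

record Follows (M : ℕ) (B B′ : Run) : Set where
  constructor follows
  field
    ends-before     : first B + 2 * length B ≤ first B′
    ends-within-lap : first B′ + 2 * length B′ ≤ first B + M

shift : ℕ → ℕ → Run → Run
shift M laps B = mkRun (first B + laps * M) (length B)

OnRun : ∀ {n} → Run → Fin (suc n) → Set
OnRun {n} B x = ∃ λ i → i < length B × toℕ x ≡ (first B + 2 * i) % suc n

point : ∀ {n} (B : Run) → Fin (length B) → Fin (suc n)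
point {n} B i = fromℕ< (m%n<n (first B + 2 * toℕ i) (suc n))

image-point⇒onRun : ∀ {n} (B : Run) {x : Fin (suc n)} → T (image (point B) x) → OnRun B x
image-point⇒onRun B x∈ with image-preimage (point B) x∈
... | i , refl = toℕ i , Finₚ.toℕ<n i , toℕ-fromℕ< _

follows⇒fits : ∀ {M B B′} → Follows M B B′ → 2 * length B ≤ M
follows⇒fits {M} {B} {B′} (follows ends-before ends-within-lap) = +-cancelˡ-≤ (first B) _ _ (begin
  first B + 2 * length B            ≤⟨ ends-before ⟩
  first B′                          ≤⟨ m≤m+n (first B′) _ ⟩
  first B′ + 2 * length B′          ≤⟨ ends-within-lap ⟩
  first B + M                       ∎)
  where open ≤-Reasoning

2+[m+2*i]≤m+2*n : ∀ m {i n} → i < n → 2 + (m + 2 * i) ≤ m + 2 * n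
2+[m+2*i]≤m+2*n m {i} {n} i<n = subst (_≤ m + 2 * n) (shuffle m (2 * i)) (+-monoʳ-≤ m (2+2*m≤2*n i<n))
  where
  shuffle : ∀ m k → m + (2 + k) ≡ 2 + (m + k)
  shuffle = solve-∀

follows-apart : ∀ {n B B′} {x y : Fin (suc n)} → Follows (suc n) B B′ → OnRun B x → OnRun B′ y → ¬ Close x y
follows-apart {n} {B} {B′} (follows ends-before ends-within-lap) (i , i<ℓ , x≡) (i′ , i′<ℓ′ , y≡) =
  residues-apart
    (≤-trans (2+[m+2*i]≤m+2*n (first B) i<ℓ) (≤-trans ends-before (m≤m+n (first B′) _)))
    (≤-trans (2+[m+2*i]≤m+2*n (first B′) i′<ℓ′) (≤-trans ends-within-lap (+-monoˡ-≤ (suc n) (m≤m+n (first B) _))))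
    x≡ y≡

run-apart : ∀ {n B} {x y : Fin (suc n)} → 2 * length B ≤ suc n → ∀ {i i′} → i < i′ → i′ < length B →
            toℕ x ≡ (first B + 2 * i) % suc n → toℕ y ≡ (first B + 2 * i′) % suc n → ¬ Close x y
run-apart {n} {B} fits i<i′ i′<ℓ x≡ y≡ =
  residues-apart
    (2+[m+2*i]≤m+2*n (first B) i<i′)
    (≤-trans (2+[m+2*i]≤m+2*n (first B) i′<ℓ)
             (≤-trans (+-monoʳ-≤ (first B) fits) (+-monoˡ-≤ (suc n) (m≤m+n (first B) _))))
    x≡ y≡

shift-onRun : ∀ {n} laps {B} {x : Fin (suc n)} → OnRun B x → OnRun (shift (suc n) laps B) x
shift-onRun {n} laps {B} (i , i<ℓ , x≡) = i , i<ℓ , (begin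
  _                                         ≡⟨ x≡ ⟩
  (first B + 2 * i) % suc n                 ≡⟨ [m+kn]%n≡m%n (first B + 2 * i) laps (suc n) ⟨
  (first B + 2 * i + laps * suc n) % suc n  ≡⟨ cong (_% suc n) (reorder (first B) (2 * i) (laps * suc n)) ⟩
  (first B + laps * suc n + 2 * i) % suc n  ∎)
  where
  open ≡-Reasoning
  reorder : ∀ s t u → s + t + u ≡ s + u + t
  reorder = solve-∀

point-injective : ∀ {n} (B : Run) → 2 * length B ≤ suc n → Injective _≡_ _≡_ (point {n} B)
point-injective {n} B fits {i} {i′} eq with Finₚ.<-cmp i i′
... | tri< i<i′ _ _ =
  ⊥-elim (run-apart {n} {B} fits i<i′ (Finₚ.toℕ<n i′) (toℕ-fromℕ< _) (toℕ-fromℕ< _) (inj₁ eq))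
... | tri≈ _ i≡i′ _ = i≡i′
... | tri> _ _ i′<i =
  ⊥-elim (run-apart {n} {B} fits i′<i (Finₚ.toℕ<n i) (toℕ-fromℕ< _) (toℕ-fromℕ< _) (inj₁ (sym eq)))

module Staircase {R n : ℕ} (run : ℕ → Run) (laps : ℕ)
                 (steps : ∀ {r} → r < R → Follows (2 + n) (run r) (run (suc r)))
                 (wraps : Follows (2 + n) (run R) (shift (2 + n) laps (run 0))) where

  staircase : Fin (suc R) × Fin (2 + n) → Bool
  staircase (r , x) = image (point (run (toℕ r))) x

  fits : ∀ (r : Fin (suc R)) → 2 * length (run (toℕ r)) ≤ 2 + n
  fits r with m≤n⇒m<n∨m≡n (≤-pred (Finₚ.toℕ<n r))
  ... | inj₁ r<R = follows⇒fits (steps r<R)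
  ... | inj₂ r≡R = subst (λ t → 2 * length (run t) ≤ 2 + n) (sym r≡R) (follows⇒fits wraps)

  successor-apart : ∀ {r r′ : Fin (suc R)} {x y : Fin (2 + n)} → toℕ r′ ≡ suc (toℕ r) % suc R →
                    OnRun (run (toℕ r)) x → OnRun (run (toℕ r′)) y → ¬ Close x y
  successor-apart {r} {r′} {x} {y} r′≡1+r x-on y-on with [1+m]%[1+n]-cases (Finₚ.toℕ<n r)
  ... | inj₁ (r<R , ≡1+r) =
    follows-apart (steps r<R) x-on (subst (λ t → OnRun (run t) y) (trans r′≡1+r ≡1+r) y-on)
  ... | inj₂ (r≡R , ≡0) =
    follows-apart (subst (λ t → Follows (2 + n) (run t) _) (sym r≡R) wraps) x-on
      (shift-onRun laps {run 0} (subst (λ t → OnRun (run t) y) (trans r′≡1+r ≡0) y-on))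

  rows-apart : ∀ {r r′ : Fin (suc R)} {x y : Fin (2 + n)} → C (suc R) r r′ →
               OnRun (run (toℕ r)) x → OnRun (run (toℕ r′)) y → ¬ Close x y
  rows-apart (inj₁ r′≡1+r) x-on y-on = successor-apart r′≡1+r x-on y-on
  rows-apart (inj₂ r≡1+r′) x-on y-on = successor-apart r≡1+r′ y-on x-on ∘ Close-sym

  row-apart : ∀ (r : Fin (suc R)) {x y} → T (staircase (r , x)) → T (staircase (r , y)) → ¬ C (2 + n) x y
  row-apart r {x} {y} x∈ y∈ Cxy
    with image-preimage (point (run (toℕ r))) x∈ | image-preimage (point (run (toℕ r))) y∈
  ... | i , refl | i′ , refl with Finₚ.<-cmp i i′
  ... | tri< i<i′ _ _ =
    run-apart {B = run (toℕ r)} (fits r) i<i′ (Finₚ.toℕ<n i′) (toℕ-fromℕ< _) (toℕ-fromℕ< _) (inj₂ Cxy)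
  ... | tri≈ _ refl _ = C-irrefl refl Cxy
  ... | tri> _ _ i′<i =
    run-apart {B = run (toℕ r)} (fits r) i′<i (Finₚ.toℕ<n i) (toℕ-fromℕ< _) (toℕ-fromℕ< _) (inj₂ (C-sym Cxy))

  staircase-independent : Independent (StrongRel (C (suc R)) (C (2 + n))) staircase
  staircase-independent (r , x) (r′ , y) x∈ y∈ (inj₁ (Crr′ , x≡y)) =
    rows-apart Crr′ (image-point⇒onRun (run (toℕ r)) x∈) (image-point⇒onRun (run (toℕ r′)) y∈) (inj₁ x≡y)
  staircase-independent (r , x) (r′ , y) x∈ y∈ (inj₂ (inj₁ (refl , Cxy))) = row-apart r x∈ y∈ Cxy
  staircase-independent (r , x) (r′ , y) x∈ y∈ (inj₂ (inj₂ (Crr′ , Cxy))) =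
    rows-apart Crr′ (image-point⇒onRun (run (toℕ r)) x∈) (image-point⇒onRun (run (toℕ r′)) y∈) (inj₂ Cxy)

  staircase-size : size₂ staircase ≡ ∑[ r < suc R ] length (run (toℕ r))
  staircase-size =
    sum-cong-≗ {suc R} (λ r → size-image (point (run (toℕ r))) (point-injective (run (toℕ r)) (fits r)))

module OddCycles (j′ k′ : ℕ) (k≤j : k′ ≤ j′) where

  j k f c : ℕ
  j = suc j′
  k = suc k′
  f = ⌊ k /2⌋
  c = ⌈ k /2⌉

  2c+2f≡2k : 2 * c + 2 * f ≡ 2 * k
  2c+2f≡2k = trans (sym (*-distribˡ-+ 2 c f)) (cong (2 *_) (trans (+-comm c f) (⌊n/2⌋+⌈n/2⌉≡n k)))

  gap : ℕ → ℕ
  gap zero = 0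
  gap (suc _) = 1

  leading : ℕ → ℕ
  leading zero = f
  leading (suc _) = c

  -- runFrom p g a r is row r of a staircase starting at column a, with p pairs of rows before its final
  -- row and an empty column after each of its first g pairs.
  runFrom : (pairs gaps offset : ℕ) → ℕ → Run
  runFrom p       g a zero          = mkRun a (leading p)
  runFrom zero    g a (suc _)       = mkRun a 0
  runFrom (suc p) g a (suc zero)    = mkRun (a + 2 * c) f
  runFrom (suc p) g a (suc (suc r)) = runFrom p (pred g) (a + 2 * k + gap g) r

  runFrom-steps : ∀ p g a {r} → r < 2 * p → Follows (suc (2 * k)) (runFrom p g a r) (runFrom p g a (suc r))
  runFrom-steps (suc p) g a {zero} _ = follows ≤-refl (begin
    a + 2 * c + 2 * f          ≡⟨ +-assoc a (2 * c) (2 * f) ⟩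
    a + (2 * c + 2 * f)        ≡⟨ cong (a +_) 2c+2f≡2k ⟩
    a + 2 * k                  ≤⟨ +-monoʳ-≤ a (n≤1+n (2 * k)) ⟩
    a + suc (2 * k)            ∎)
    where open ≤-Reasoning
  runFrom-steps (suc p) g a {suc zero} _ = follows (begin
    a + 2 * c + 2 * f          ≡⟨ +-assoc a (2 * c) (2 * f) ⟩
    a + (2 * c + 2 * f)        ≡⟨ cong (a +_) 2c+2f≡2k ⟩
    a + 2 * k                  ≤⟨ m≤m+n (a + 2 * k) (gap g) ⟩
    a + 2 * k + gap g          ∎) (begin
    a + 2 * k + gap g + 2 * leading p
                               ≤⟨ +-mono-≤ (+-monoʳ-≤ (a + 2 * k) (gap≤1 g)) (*-monoʳ-≤ 2 (leading≤c p)) ⟩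
    a + 2 * k + 1 + 2 * c      ≡⟨ reorder a (2 * k) (2 * c) ⟩
    a + 2 * c + suc (2 * k)    ∎)
    where
    open ≤-Reasoning
    gap≤1 : ∀ g → gap g ≤ 1
    gap≤1 zero = z≤n
    gap≤1 (suc _) = ≤-refl
    leading≤c : ∀ p → leading p ≤ c
    leading≤c zero = ⌊n/2⌋≤⌈n/2⌉ k
    leading≤c (suc p) = ≤-refl
    reorder : ∀ a K C → a + K + 1 + C ≡ a + C + suc K
    reorder = solve-∀
  runFrom-steps (suc p) g a {suc (suc r)} r<2+2p =
    runFrom-steps p (pred g) (a + 2 * k + gap g) (≤-pred (≤-pred (subst (suc (suc (suc r)) ≤_) (*-suc 2 p) r<2+2p)))

  runFrom-last : ∀ p g a → g ≤ p → runFrom p g a (2 * p) ≡ mkRun (a + p * (2 * k) + g) f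
  runFrom-last zero .zero a z≤n = cong (λ t → mkRun t f) (sym (trans (+-identityʳ (a + 0)) (+-identityʳ a)))
  runFrom-last (suc p) g a g≤1+p = begin
    runFrom (suc p) g a (2 * suc p)                       ≡⟨ cong (runFrom (suc p) g a) (*-suc 2 p) ⟩
    runFrom p (pred g) (a + 2 * k + gap g) (2 * p)        ≡⟨ runFrom-last p (pred g) _ (pred-mono-≤ g≤1+p) ⟩
    mkRun (a + 2 * k + gap g + p * (2 * k) + pred g) f    ≡⟨ cong (λ t → mkRun t f) (regroup g) ⟩
    mkRun (a + suc p * (2 * k) + g) f                     ∎
    where
    open ≡-Reasoning
    regroup : ∀ g → a + 2 * k + gap g + p * (2 * k) + pred g ≡ a + (2 * k + p * (2 * k)) + g
    regroup zero = no-gap a (2 * k) (p * (2 * k))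
      where
      no-gap : ∀ a K P → a + K + 0 + P + 0 ≡ a + (K + P) + 0
      no-gap = solve-∀
    regroup (suc g) = one-gap a (2 * k) (p * (2 * k)) g
      where
      one-gap : ∀ a K P g → a + K + 1 + P + g ≡ a + (K + P) + suc g
      one-gap = solve-∀

  runFrom-lengths : ∀ p g a → ∑[ r < suc (2 * p) ] length (runFrom p g a (toℕ r)) ≡ p * k + f
  runFrom-lengths zero g a = +-identityʳ f
  runFrom-lengths (suc p) g a = begin
    ∑[ r < suc (2 * suc p) ] length (runFrom (suc p) g a (toℕ r))
                               ≡⟨ ∑-toℕ-cast (cong suc (*-suc 2 p)) (length ∘ runFrom (suc p) g a) ⟩
    c + (f + ∑[ r < suc (2 * p) ] length (runFrom p (pred g) (a + 2 * k + gap g) (toℕ r)))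
                               ≡⟨ cong (λ t → c + (f + t)) (runFrom-lengths p (pred g) (a + 2 * k + gap g)) ⟩
    c + (f + (p * k + f))      ≡⟨ regroup c f (p * k) ⟩
    f + c + p * k + f          ≡⟨ cong (λ t → t + p * k + f) (⌊n/2⌋+⌈n/2⌉≡n k) ⟩
    k + p * k + f              ∎
    where
    open ≡-Reasoning
    regroup : ∀ c f P → c + (f + (P + f)) ≡ f + c + P + f
    regroup = solve-∀

  gaps : ℕ
  gaps = j ∸ 2 * f

  run : ℕ → Run
  run = runFrom j gaps 0

  2f≤j : 2 * f ≤ j
  2f≤j = ≤-trans (2*⌊n/2⌋≤n k) (s≤s k≤j)

  last-end : j * (2 * k) + gaps + 2 * f ≡ j * suc (2 * k)
  last-end = begin
    j * (2 * k) + gaps + 2 * f       ≡⟨ +-assoc (j * (2 * k)) gaps (2 * f) ⟩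
    j * (2 * k) + (gaps + 2 * f)     ≡⟨ cong (j * (2 * k) +_) (m∸n+n≡m 2f≤j) ⟩
    j * (2 * k) + j                  ≡⟨ +-comm (j * (2 * k)) j ⟩
    j + j * (2 * k)                  ≡⟨ *-suc j (2 * k) ⟨
    j * suc (2 * k)                  ∎
    where open ≡-Reasoning

  wraps : Follows (suc (2 * k)) (run (2 * j)) (shift (suc (2 * k)) j (run 0))
  wraps = subst (λ B → Follows (suc (2 * k)) B (shift (suc (2 * k)) j (run 0)))
                (sym (runFrom-last j gaps 0 (m∸n≤m j (2 * f))))
    (follows (≤-reflexive last-end) (begin
      j * suc (2 * k) + 2 * c                  ≡⟨ cong (_+ 2 * c) last-end ⟨
      j * (2 * k) + gaps + 2 * f + 2 * c       ≡⟨ +-assoc (j * (2 * k) + gaps) (2 * f) (2 * c) ⟩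
      j * (2 * k) + gaps + (2 * f + 2 * c)     ≡⟨ cong (j * (2 * k) + gaps +_) (trans (+-comm (2 * f) _) 2c+2f≡2k) ⟩
      j * (2 * k) + gaps + 2 * k               ≤⟨ +-monoʳ-≤ (j * (2 * k) + gaps) (n≤1+n (2 * k)) ⟩
      j * (2 * k) + gaps + suc (2 * k)         ∎))
    where open ≤-Reasoning

  open Staircase run j (runFrom-steps j gaps 0) wraps

  witness : IndependentOfSize₂ (StrongRel (C (suc (2 * j))) (C (suc (2 * k)))) (j * k + f)
  witness = staircase , staircase-independent , trans staircase-size (runFrom-lengths j gaps 0)

  bound : α₂≤ (StrongRel (C (suc (2 * j))) (C (suc (2 * k)))) (j * k + f)
  bound S S-ind = subst (size₂ S ≤_) half (2*m≤n⇒m≤⌊n/2⌋ (strong-cycle-bound (C-α≤ (2 * k)) S S-ind))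
    where
    half : ⌊ suc (2 * j) * ⌊ suc (2 * k) /2⌋ /2⌋ ≡ j * k + f
    half = begin
      ⌊ suc (2 * j) * ⌊ suc (2 * k) /2⌋ /2⌋    ≡⟨ cong (λ t → ⌊ suc (2 * j) * t /2⌋) (⌈2*n/2⌉≡n k) ⟩
      ⌊ suc (2 * j) * k /2⌋                    ≡⟨ cong ⌊_/2⌋ (regroup j k) ⟩
      ⌊ 2 * (j * k) + k /2⌋                    ≡⟨ ⌊2*m+n/2⌋≡m+⌊n/2⌋ (j * k) k ⟩
      j * k + f                                ∎
      where
      open ≡-Reasoning
      regroup : ∀ j k → suc (2 * j) * k ≡ 2 * (j * k) + k
      regroup = solve-∀

ccc-K-K : ∀ m n → 2 ≤ m → 2 ≤ n → IsCcc (K m ⊠ K n) 1 × IsCcc (K m ⊙ K n) 1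
ccc-K-K _ _ 2≤m@(s≤s _) 2≤n@(s≤s _) =
  strong-isCcc-coverˡ Kₘ Kₙ K-cover (proj₁ K-α) K-α , lex-isCcc-α Kₘ Kₙ K-α K-α
  where
  Kₘ = K-isConnectedGraph 2≤m
  Kₙ = K-isConnectedGraph 2≤n

ccc-K-C : ∀ m n → 2 ≤ m → 3 ≤ n → IsCcc (K m ⊠ C n) ⌊ n /2⌋ × IsCcc (K m ⊙ C n) ⌊ n /2⌋
ccc-K-C m n 2≤m@(s≤s _) 3≤n@(s≤s _) =
  subst (IsCcc (K m ⊠ C n)) (*-identityˡ _) (strong-isCcc-coverˡ Kₘ Cₙ K-cover (proj₁ K-α) C-α) ,
  subst (IsCcc (K m ⊙ C n)) (*-identityˡ _) (lex-isCcc-α Kₘ Cₙ K-α C-α)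
  where
  Kₘ = K-isConnectedGraph 2≤m
  Cₙ = C-isConnectedGraph (<⇒≤ 3≤n)

ccc-K-P : ∀ m n → 2 ≤ m → 2 ≤ n → IsCcc (K m ⊠ P n) ⌈ n /2⌉ × IsCcc (K m ⊙ P n) ⌈ n /2⌉
ccc-K-P m n 2≤m@(s≤s _) 2≤n =
  subst (IsCcc (K m ⊠ P n)) (*-identityˡ _) (strong-isCcc-coverˡ Kₘ Pₙ K-cover (proj₁ K-α) P-α) ,
  subst (IsCcc (K m ⊙ P n)) (*-identityˡ _) (lex-isCcc-α Kₘ Pₙ K-α P-α)
  where
  Kₘ = K-isConnectedGraph 2≤m
  Pₙ = P-isConnectedGraph 2≤n

ccc-C⊙C : ∀ m n → 3 ≤ m → 3 ≤ n → IsCcc (C m ⊙ C n) (⌊ m /2⌋ * ⌊ n /2⌋)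
ccc-C⊙C _ _ 3≤m@(s≤s _) 3≤n@(s≤s _) =
  lex-isCcc-α (C-isConnectedGraph (<⇒≤ 3≤m)) (C-isConnectedGraph (<⇒≤ 3≤n)) C-α C-α

ccc-C₂ⱼ⊠C : ∀ j n → 3 ≤ 2 * j → 3 ≤ n → IsCcc (C (2 * j) ⊠ C n) (j * ⌊ n /2⌋)
ccc-C₂ⱼ⊠C (suc j) _ 3≤2j 3≤n@(s≤s _) =
  strong-isCcc-coverˡ (C-isConnectedGraph (<⇒≤ 3≤2j)) (C-isConnectedGraph (<⇒≤ 3≤n))
    (pairCover ≤-refl P⊆C) (subst (IndependentOfSize (C (2 * suc j))) (⌊2*n/2⌋≡n (suc j)) (proj₁ C-α)) C-α

ccc-C₂ⱼ₊₁⊠C₂ₖ₊₁ : ∀ j k → 1 ≤ j → 1 ≤ k → k ≤ j → IsCcc (C (2 * j + 1) ⊠ C (2 * k + 1)) (j * k + ⌊ k /2⌋)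
ccc-C₂ⱼ₊₁⊠C₂ₖ₊₁ (suc j) (suc k) _ _ (s≤s k≤j) =
  subst₂ (λ M N → IsCcc (C M ⊠ C N) (suc j * suc k + ⌊ suc k /2⌋)) (+-comm 1 (2 * suc j)) (+-comm 1 (2 * suc k))
    (strong-isCcc (C-isConnectedGraph (s≤s (s≤s z≤n))) (C-isConnectedGraph (s≤s (s≤s z≤n))) witness bound)
  where open OddCycles j k k≤j using (witness; bound)

ccc-C-P : ∀ m n → 3 ≤ m → 2 ≤ n →
          IsCcc (C m ⊠ P n) (⌊ m /2⌋ * ⌈ n /2⌉) × IsCcc (C m ⊙ P n) (⌊ m /2⌋ * ⌈ n /2⌉)
ccc-C-P _ _ 3≤m@(s≤s _) 2≤n =
  strong-isCcc-coverʳ Cₘ Pₙ C-α P-cover (proj₁ P-α) , lex-isCcc-α Cₘ Pₙ C-α P-α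
  where
  Cₘ = C-isConnectedGraph (<⇒≤ 3≤m)
  Pₙ = P-isConnectedGraph 2≤n

ccc-P-P : ∀ m n → 2 ≤ m → 2 ≤ n →
          IsCcc (P m ⊠ P n) (⌈ m /2⌉ * ⌈ n /2⌉) × IsCcc (P m ⊙ P n) (⌈ m /2⌉ * ⌈ n /2⌉)
ccc-P-P _ _ 2≤m 2≤n =
  strong-isCcc-coverˡ Pₘ Pₙ P-cover (proj₁ P-α) P-α , lex-isCcc-α Pₘ Pₙ P-α P-α
  where
  Pₘ = P-isConnectedGraph 2≤m
  Pₙ = P-isConnectedGraph 2≤n

mainTheorem16 :
    (∀ (m n : ℕ) → 2 ≤ m → 2 ≤ n →
        IsCcc (K m ⊠ K n) 1 × IsCcc (K m ⊙ K n) 1)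
    × (∀ (m n : ℕ) → 2 ≤ m → 3 ≤ n →
        IsCcc (K m ⊠ C n) ⌊ n /2⌋ × IsCcc (K m ⊙ C n) ⌊ n /2⌋)
    × (∀ (m n : ℕ) → 2 ≤ m → 2 ≤ n →
        IsCcc (K m ⊠ P n) ⌈ n /2⌉ × IsCcc (K m ⊙ P n) ⌈ n /2⌉)
    × (∀ (m n : ℕ) → 3 ≤ m → 3 ≤ n →
        IsCcc (C m ⊙ C n) (⌊ m /2⌋ * ⌊ n /2⌋))
    × (∀ (j n : ℕ) → 3 ≤ 2 * j → 3 ≤ n →
        IsCcc (C (2 * j) ⊠ C n) (j * ⌊ n /2⌋))
    × (∀ (j k : ℕ) → 1 ≤ j → 1 ≤ k → k ≤ j →
        IsCcc (C (2 * j + 1) ⊠ C (2 * k + 1)) (j * k + ⌊ k /2⌋))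
    × (∀ (m n : ℕ) → 3 ≤ m → 2 ≤ n →
        IsCcc (C m ⊠ P n) (⌊ m /2⌋ * ⌈ n /2⌉) × IsCcc (C m ⊙ P n) (⌊ m /2⌋ * ⌈ n /2⌉))
    × (∀ (m n : ℕ) → 2 ≤ m → 2 ≤ n →
        IsCcc (P m ⊠ P n) (⌈ m /2⌉ * ⌈ n /2⌉) × IsCcc (P m ⊙ P n) (⌈ m /2⌉ * ⌈ n /2⌉))
mainTheorem16 = ccc-K-K , ccc-K-C , ccc-K-P , ccc-C⊙C , ccc-C₂ⱼ⊠C , ccc-C₂ⱼ₊₁⊠C₂ₖ₊₁ , ccc-C-P , ccc-P-P
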